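{- Let $\Delta\ge 2$ be an integer and $\gamma=\frac{3}{2^{2/3}}+2^{2/3}\Delta^{ -1/3}+\Delta^{ -2/3}$. Let $G$ be a finite graph of maximum degree at most $\Delta$ and $L$ a list assignment of $G$ in which every list has size at least $\Delta(\Delta-1)(1+\gamma\Delta^{ -1/3})+1$. Then for every vertex $v$ of $G$, $$|C_L(G)|\ge \Delta(\Delta-1)\bigl(1+2^{1/3}\Delta^{ -1/3}\bigr)\,|C_L(G\setminus\{v\})|.$$
   Context: A sequence $s_1\ldots s_{2k}$ ($k\ge1$) is a square if $s_i=s_{i+k}$ for all $i$; a sequence is non-repetitive if it has no consecutive subsequence that is a square. A vertex coloring of a graph is non-repetitive if the color sequence of every (simple) path is non-repetitive. A list assignment $L$ assigns to each vertex $v$ a set $L(v)$ of colors. For a graph $H$ (here $H=G$ or $H=G\setminus\{v\}$, the graph obtained by deleting vertex $v$), $C_L(H)$ denotes the set of non-repetitive vertex colorings of $H$ in which every vertex $u$ receives a color from $L(u)$ (the empty graph has exactly one coloring). -}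

module Defs where

open import Data.Nat using (ℕ; zero; suc; _+_; _*_; _∸_; _^_; _≤_; _<_)
open import Data.Bool using (Bool; true; false; if_then_else_; T)
open import Data.Fin using (Fin; punchIn)
open import Data.List using (List; []; _++_; map; length; allFin)
open import Data.Nat.ListAction using (sum)
open import Data.List.Membership.Propositional using (_∈_)
open import Data.List.Relation.Unary.Unique.Propositional using (Unique)
open import Data.List.Relation.Unary.Linked using (Linked)
open import Data.Vec using (Vec; lookup)
open import Data.Product using (Σ; ∃; _×_; _,_)
open import Relation.Binary.PropositionalEquality using (_≡_; _≢_)
open import Relation.Nullary using (¬_)

record Graph (n : ℕ) : Set where
  field
    adj   : Fin n → Fin n → Bool
    sym   : ∀ u w → adj u w ≡ adj w u
    irrefl : ∀ u → adj u u ≡ false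
open Graph public

degree : ∀ {n} → Graph n → Fin n → ℕ
degree {n} G u = sum (map (λ w → if adj G u w then 1 else 0) (allFin n))

MaxDegreeAtMost : ∀ {n} → Graph n → ℕ → Set
MaxDegreeAtMost {n} G Δ = ∀ u → degree G u ≤ Δ

deleteVertex : ∀ {m} → Graph (suc m) → Fin (suc m) → Graph m
deleteVertex G v = record
  { adj = λ i j → adj G (punchIn v i) (punchIn v j)
  ; sym = λ i j → sym G (punchIn v i) (punchIn v j)
  ; irrefl = λ i → irrefl G (punchIn v i)
  }

IsPath : ∀ {n} → Graph n → List (Fin n) → Set
IsPath G ps = Unique ps × Linked (λ a b → T (adj G a b)) ps

IsSquare : List ℕ → Set
IsSquare s = Σ (List ℕ) λ u → u ≢ [] × s ≡ u ++ u

NonRepetitive : List ℕ → Set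
NonRepetitive s = ¬ (Σ (List ℕ) λ a → Σ (List ℕ) λ w → Σ (List ℕ) λ b →
                      s ≡ a ++ (w ++ b) × IsSquare w)

NonRepColoring : ∀ {n} → Graph n → Vec ℕ n → Set
NonRepColoring G c = ∀ ps → IsPath G ps → NonRepetitive (map (lookup c) ps)

-- a list assignment assigns to each vertex a list of colors; the set L(v) is
-- represented by a duplicate-free list
ListAssignment : ℕ → Set
ListAssignment n = Fin n → List ℕ

InCL : ∀ {n} → Graph n → ListAssignment n → Vec ℕ n → Set
InCL G L c = (∀ u → lookup c u ∈ L u) × NonRepColoring G c

-- cs is a duplicate-free enumeration of the predicate P; then |P| = length cs
Enumerates : {A : Set} → (A → Set) → List A → Set
Enumerates {A} P cs = Unique cs × (∀ (x : A) → (x ∈ cs → P x) × (P x → x ∈ cs))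

-- The real-number quantities, encoded exactly in ℕ arithmetic.
-- Let a = 2^{1/3} Δ^{-1/3} (the positive real with a³ = 2/Δ).  Then
--   γ Δ^{-1/3} = (3/2) a + a² + a³/2, so 1 + γΔ^{-1/3} = P(a) with
--   P(x) = 1 + 3x/2 + x² + x³/2 (increasing on x ≥ 0).
-- For a rational p/q (q > 0, p ≥ 0) we have p/q < a iff Δ p³ < 2 q³.

-- "s ≥ Δ(Δ-1)(1 + γ Δ^{-1/3}) + 1", i.e. s ≥ 1 + D·P(a) with D = Δ(Δ-1).
-- Since P is continuous and increasing, this holds iff s ≥ 1 + D·P(p/q)
-- for every rational 0 ≤ p/q < a.  Multiplying by 2q³:
ListSizeBound : ℕ → ℕ → Set
ListSizeBound Δ s =
  ∀ (p q : ℕ) → 0 < q → Δ * p ^ 3 < 2 * q ^ 3 →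
    2 * q ^ 3 + (Δ * (Δ ∸ 1)) * (2 * q ^ 3 + 3 * p * q ^ 2 + 2 * p ^ 2 * q + p ^ 3)
      ≤ 2 * q ^ 3 * s

-- "N ≥ Δ(Δ-1)(1 + 2^{1/3}Δ^{-1/3}) M", i.e. N ≥ DM(1+a), equivalently
-- DM ≤ N and (N - DM)³ ≥ (DM)³·(2/Δ).
CountBound : ℕ → ℕ → ℕ → Set
CountBound Δ N M =
  (Δ * (Δ ∸ 1) * M ≤ N) ×
  (2 * (Δ * (Δ ∸ 1) * M) ^ 3 ≤ Δ * (N ∸ Δ * (Δ ∸ 1) * M) ^ 3)

module Submission where

-- Rosenfeld's counting argument.  Let D = Δ(Δ - 1), let x = p/q be a rational slightly above the
-- root a = (2/Δ)^{1/3} (GoodRatio), and let C(S) be the non-repetitive L-colourings of a vertex set S.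
-- By induction on |S|, D(1 + x)·|C(S - v)| ≤ |C(S)| for every v ∈ S.  Extending a colouring of S - v
-- by a colour of L(v) gives either a colouring in C(S) or a repetition along a path through v; with
-- the path oriented so that v lies in its first half of i + 1 vertices, the extension is determined by
-- the path and its restriction to S minus that half.  There are at most (i + 1)Δ(Δ - 1)^{2i} such
-- paths and, by induction, at most |C(S - v)|/(D(1 + x))^i such restrictions, so
--     |L(v)|·|C(S - v)| ≤ |C(S)| + |C(S - v)|·∑ᵢ (i + 1)Δ(Δ - 1)^{2i}/(D(1 + x))^i.
-- The series sums to at most 1 + (Δ - 1)(1 + 1/x)², and 1 + D(1 + x) + (Δ - 1)(1 + 1/x)² is the
-- assumed list size 1 + D(1 + γΔ^{-1/3}) at x = a, so for x close enough to a the list size bound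
-- gives the claim.  Taking S = V yields the theorem.

open import Defs hiding (sym)
open import Data.Nat hiding (_≟_; ∣_-_∣)
open import Data.Nat.Properties hiding (_≟_)
open import Data.Nat.Properties using () renaming (_≟_ to _≟ℕ_)
open import Data.Nat.Solver using (module +-*-Solver)
open import Data.Nat.Tactic.RingSolver using (solve-∀)
open import Data.Nat.ListAction using (sum)
open import Data.Bool using (Bool; true; false; T; T?; if_then_else_)
open import Data.Fin using (Fin; zero; suc; _≟_; punchIn; punchOut)
open import Data.Fin.Properties using (punchIn-punchOut)
open import Data.Fin.Subset using (Subset; ⊤; ⁅_⁆; _-_; _─_; _⊆_; ∣_∣; inside; outside)
  renaming (_∈_ to _∈ₛ_; _∉_ to _∉ₛ_)
open import Data.Fin.Subset.Properties
  using (_∈?_; ∈⊤; x∈⁅x⁆; p─q⊆p; p─x─y≡p─y─x; x∈p∧x≢y⇒x∈p-y; x∈p⇒∣p-x∣<∣p∣)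
open import Data.Product using (∃-syntax; _×_; _,_; proj₁; proj₂)
open import Data.Product.Properties using () renaming (≡-dec to ≡-dec×)
open import Data.Sum using (_⊎_; inj₁; inj₂)
open import Data.Sum.Properties using (inj₂-injective) renaming (≡-dec to ≡-dec⊎)
open import Data.Empty using (⊥-elim)
open import Function using (id; _∘_)
open import Data.List
  using (List; []; _∷_; _++_; [_]; map; length; filter; take; drop; reverse; concatMap;
         cartesianProduct; cartesianProductWith; upTo; allFin)
open import Data.List.Properties
  using (length-++; length-map; length-take; length-drop; length-reverse; length-filter; length-tabulate;
         length-upTo; take++drop≡id; take-map; drop-map; reverse-++; unfold-reverse; reverse-involutive;
         reverse-map; ++-assoc; ++-identityʳ; ++-conicalʳ; ∷-injectiveˡ; ∷-injectiveʳ; filter-notAll;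
         map-∘; map-cong; map-cong-local)
  renaming (≡-dec to ≡-decList)
open import Data.List.Membership.Propositional using (_∈_; _∉_; lose)
open import Data.List.Membership.Propositional.Properties
  using (∈-filter⁺; ∈-filter⁻; ∈-map⁺; ∈-++⁺ˡ; ∈-++⁺ʳ; ∈-++⁻; ∈-∃++; ∈-concatMap⁺; ∈-allFin; ∈-upTo⁺;
         ∈-upTo⁻; ∈-cartesianProductWith⁺; ∈-cartesianProductWith⁻; ∈-cartesianProduct⁻)
open import Data.List.Relation.Unary.All as All using (All; []; _∷_)
open import Data.List.Relation.Unary.Any as Any using (Any; here; there)
import Data.List.Relation.Unary.Any.Properties as Any
open import Data.List.Relation.Unary.AllPairs using (allPairs?)
open import Data.List.Relation.Unary.Linked as Linked using (Linked; []; [-]; _∷_; linked?)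
import Data.List.Relation.Unary.Linked.Properties as Linked
open import Data.List.Relation.Unary.Unique.Propositional using (Unique; []; _∷_)
import Data.List.Relation.Unary.Unique.Propositional.Properties as Unique
open import Data.Vec using (Vec; []; _∷_; lookup; tabulate; _[_]≔_; insertAt; removeAt; here; there)
open import Data.Vec.Properties
  using (lookup∘tabulate; lookup∘update; lookup∘update′; insertAt-lookup; insertAt-punchIn; removeAt-insertAt)
  renaming (≡-dec to ≡-decVec; ∷-injective to ∷-injectiveVec)
open import Data.Vec.Relation.Binary.Pointwise.Extensional using (ext; Pointwise-≡⇒≡)
open import Relation.Nullary using (Dec; yes; no; ¬_; does; contradiction)
open import Relation.Nullary.Decidable using (_×-dec_; ¬?; map′; dec-true; dec-false)
open import Relation.Unary using (Decidable)
open import Relation.Binary.Definitions using (DecidableEquality)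
open import Relation.Binary.PropositionalEquality hiding ([_])

private
  variable
    A B : Set
    n : ℕ

-- Arithmetic

crossing : ∀ {ℓ} {P : ℕ → Set ℓ} → Decidable P → ¬ P 0 →
           ∀ {k} → P k → ∃[ m ] m < k × ¬ P m × P (suc m)
crossing P? ¬P0 {zero} P0 = contradiction P0 ¬P0
crossing P? ¬P0 {suc k} Pk with P? k
... | no ¬Pk = k , ≤-refl , ¬Pk , Pk
... | yes Pk′ with crossing P? ¬P0 Pk′
...   | m , m<k , ¬Pm , Psm = m , m<n⇒m<1+n m<k , ¬Pm , Psm

^-distribʳ-* : ∀ m n i → (m * n) ^ i ≡ m ^ i * n ^ i
^-distribʳ-* m n zero = refl
^-distribʳ-* m n (suc i) = begin
  m * n * (m * n) ^ i     ≡⟨ cong (m * n *_) (^-distribʳ-* m n i) ⟩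
  m * n * (m ^ i * n ^ i) ≡⟨ interchange m n (m ^ i) (n ^ i) ⟩
  m * m ^ i * (n * n ^ i) ∎
  where
  open ≡-Reasoning
  interchange : ∀ m n a b → m * n * (a * b) ≡ m * a * (n * b)
  interchange = solve-∀

sumBelow : ℕ → (ℕ → ℕ) → ℕ
sumBelow zero f = 0
sumBelow (suc J) f = sumBelow J f + f J

-- ∑_{i<J} (i+1) qⁱ y^(J-1-i), the partial sums of the derivative of a geometric series.
derivedSeries : ℕ → ℕ → ℕ → ℕ
derivedSeries y q zero = 0
derivedSeries y q (suc J) = y * derivedSeries y q J + suc J * q ^ J

derivedSeries-closed : ∀ p q J →
  p * p * derivedSeries (p + q) q J + q ^ J * (p + q + J * p) ≡ (p + q) ^ suc J
derivedSeries-closed p q zero = base p q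
  where
  base : ∀ p q → p * p * 0 + 1 * (p + q + 0 * p) ≡ (p + q) * 1
  base = solve-∀
derivedSeries-closed p q (suc J) = begin
  p * p * (y * σ + suc J * t) + q * t * (y + suc J * p) ≡⟨ unfold p q J t σ ⟩
  y * (p * p * σ + t * (y + J * p))                    ≡⟨ cong (y *_) (derivedSeries-closed p q J) ⟩
  y * y ^ suc J                                        ∎
  where
  open ≡-Reasoning
  y t σ : ℕ
  y = p + q
  t = q ^ J
  σ = derivedSeries y q J
  unfold : ∀ p q J t a → p * p * ((p + q) * a + (1 + J) * t) + q * t * ((p + q) + (1 + J) * p)
                       ≡ (p + q) * (p * p * a + t * ((p + q) + J * p))
  unfold = solve-∀

sumBelow-≤-derivedSeries : ∀ y q K J (c : ℕ → ℕ) →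
  (∀ i → i < J → y ^ i * c i ≤ suc i * q ^ i * K) →
  y ^ J * sumBelow J c ≤ y * derivedSeries y q J * K
sumBelow-≤-derivedSeries y q K zero c h = z≤n
sumBelow-≤-derivedSeries y q K (suc J) c h = begin
  y * y ^ J * (sumBelow J c + c J)                      ≡⟨ distrib y (y ^ J) (sumBelow J c) (c J) ⟩
  y * (y ^ J * sumBelow J c) + y * (y ^ J * c J)
    ≤⟨ +-mono-≤ (*-monoʳ-≤ y (sumBelow-≤-derivedSeries y q K J c (λ i i<J → h i (m<n⇒m<1+n i<J))))
                (*-monoʳ-≤ y (h J ≤-refl)) ⟩
  y * (y * derivedSeries y q J * K) + y * (suc J * q ^ J * K)
    ≡⟨ collect y (derivedSeries y q J) K (suc J * q ^ J) ⟩
  y * (y * derivedSeries y q J + suc J * q ^ J) * K      ∎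
  where
  open ≤-Reasoning
  distrib : ∀ y Y s c → y * Y * (s + c) ≡ y * (Y * s) + y * (Y * c)
  distrib = solve-∀
  collect : ∀ y A K t → y * (y * A * K) + y * (t * K) ≡ y * (y * A + t) * K
  collect = solve-∀

-- ∑ (i+1) xⁱ ≤ 1/(1-x)² for x = q/(p+q).
derivedGeometric-bound : ∀ p q K J (c : ℕ → ℕ) → 0 < p →
  (∀ i → i < J → (p + q) ^ i * c i ≤ suc i * q ^ i * K) →
  p * p * sumBelow J c ≤ (p + q) * (p + q) * K
derivedGeometric-bound p q K J c p>0 h =
  *-cancelˡ-≤ (y ^ J) {{m^n≢0 y J {{>-nonZero y>0}}}} (begin
    y ^ J * (p * p * sumBelow J c)       ≡⟨ swap (y ^ J) (p * p) (sumBelow J c) ⟩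
    p * p * (y ^ J * sumBelow J c)       ≤⟨ *-monoʳ-≤ (p * p) (sumBelow-≤-derivedSeries y q K J c h) ⟩
    p * p * (y * σ * K)                  ≡⟨ regroup p y σ K ⟩
    p * p * σ * (y * K)                  ≤⟨ *-monoˡ-≤ (y * K) (m≤m+n (p * p * σ) (q ^ J * (y + J * p))) ⟩
    (p * p * σ + q ^ J * (y + J * p)) * (y * K) ≡⟨ cong (_* (y * K)) (derivedSeries-closed p q J) ⟩
    y ^ suc J * (y * K)                  ≡⟨ regroup′ y (y ^ J) K ⟩
    y ^ J * (y * y * K)                  ∎)
  where
  open ≤-Reasoning
  y σ : ℕ
  y = p + q
  σ = derivedSeries y q J
  y>0 : 0 < y
  y>0 = ≤-trans p>0 (m≤m+n p q)
  swap : ∀ a b c → a * (b * c) ≡ b * (a * c)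
  swap = solve-∀
  regroup : ∀ p y σ K → p * p * (y * σ * K) ≡ p * p * σ * (y * K)
  regroup = solve-∀
  regroup′ : ∀ y Y K → y * Y * (y * K) ≡ Y * (y * y * K)
  regroup′ = solve-∀

-- With x = p/q this is  1 + Δ(Δ-1)(1 + x) + (Δ-1)(1 + 1/x)² ≤ s  (Δ = suc e), multiplied by q p².
StepCondition : ℕ → ℕ → ℕ → ℕ → Set
StepCondition e s p q =
  q * (p * p) + suc e * e * (p + q) * (p * p) + e * ((p + q) * (p + q)) * q ≤ s * q * (p * p)

Δe^2i≤e[Δe]^i : ∀ e i → suc e * e ^ (suc i + suc i) ≤ e * (suc e * e) ^ suc i
Δe^2i≤e[Δe]^i e i = begin
  Δ * e ^ (suc i + suc i)          ≡⟨ cong (Δ *_) (^-distribˡ-+-* e (suc i) (suc i)) ⟩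
  Δ * ((e * e ^ i) * (e * e ^ i))  ≡⟨ regroup Δ e (e ^ i) ⟩
  Δ * e * e * e ^ i * e ^ i        ≤⟨ *-monoʳ-≤ (Δ * e * e * e ^ i) (^-monoˡ-≤ i (n≤1+n e)) ⟩
  Δ * e * e * e ^ i * Δ ^ i        ≡⟨ regroup′ Δ e (e ^ i) (Δ ^ i) ⟩
  e * (Δ * e * (Δ ^ i * e ^ i))    ≡⟨ cong (λ z → e * (Δ * e * z)) (sym (^-distribʳ-* Δ e i)) ⟩
  e * (Δ * e) ^ suc i              ∎
  where
  open ≤-Reasoning
  Δ : ℕ
  Δ = suc e
  regroup : ∀ Δ e a → Δ * ((e * a) * (e * a)) ≡ Δ * e * e * a * a
  regroup = solve-∀
  regroup′ : ∀ Δ e a b → Δ * e * e * a * b ≡ e * (Δ * e * (b * a))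
  regroup′ = solve-∀

later-term-bound : ∀ e y q M i b → 1 ≤ e →
  (suc e * e * y) ^ suc i * b ≤ suc (suc i) * (suc e * e ^ (suc i + suc i)) * (q ^ suc i * M) →
  y ^ suc i * b ≤ suc (suc i) * q ^ suc i * (e * M)
later-term-bound e y q M i b e≥1 h =
  *-cancelˡ-≤ (D ^ suc i) {{m^n≢0 D (suc i) {{>-nonZero D>0}}}} (begin
    D ^ suc i * (y ^ suc i * b)   ≡⟨ sym (*-assoc (D ^ suc i) (y ^ suc i) b) ⟩
    D ^ suc i * y ^ suc i * b     ≡⟨ cong (_* b) (sym (^-distribʳ-* D y (suc i))) ⟩
    (D * y) ^ suc i * b           ≤⟨ h ⟩
    j * (suc e * e ^ (suc i + suc i)) * (q ^ suc i * M)
      ≤⟨ *-monoˡ-≤ (q ^ suc i * M) (*-monoʳ-≤ j (Δe^2i≤e[Δe]^i e i)) ⟩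
    j * (e * D ^ suc i) * (q ^ suc i * M) ≡⟨ regroup j e (D ^ suc i) (q ^ suc i) M ⟩
    D ^ suc i * (j * q ^ suc i * (e * M)) ∎)
  where
  open ≤-Reasoning
  D j : ℕ
  D = suc e * e
  j = suc (suc i)
  D>0 : 0 < D
  D>0 = *-mono-≤ {1} {suc e} {1} {e} (s≤s z≤n) e≥1
  regroup : ∀ j e d Q M → j * (e * d) * (Q * M) ≡ d * (j * Q * (e * M))
  regroup = solve-∀

module _ (e p q M : ℕ) (t : ℕ → ℕ) (p>0 : 0 < p) (first : t 0 ≤ suc e * M)
         (later : ∀ i → (p + q) ^ suc i * t (suc i) ≤ suc (suc i) * q ^ suc i * (e * M)) where

  private
    y : ℕ
    y = p + q

    -- Only the part of t 0 beyond M fits the pattern (i + 1) qⁱ/yⁱ of the later terms.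
    excess : ℕ → ℕ
    excess zero = t 0 ∸ M
    excess (suc i) = t (suc i)

    excess-bound : ∀ i → y ^ i * excess i ≤ suc i * q ^ i * (e * M)
    excess-bound zero = begin
      1 * (t 0 ∸ M)     ≡⟨ +-identityʳ (t 0 ∸ M) ⟩
      t 0 ∸ M           ≤⟨ ∸-monoˡ-≤ M first ⟩
      M + e * M ∸ M     ≡⟨ m+n∸m≡n M (e * M) ⟩
      e * M             ≡⟨ +-identityʳ (e * M) ⟨
      1 * 1 * (e * M)   ∎
      where open ≤-Reasoning
    excess-bound (suc i) = later i

    sumBelow-≤-excess : ∀ J → sumBelow J t ≤ M + sumBelow J excess
    sumBelow-≤-excess zero = z≤n
    sumBelow-≤-excess (suc zero) = m≤n+m∸n (t 0) M
    sumBelow-≤-excess (suc (suc J)) = begin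
      sumBelow (suc J) t + t (suc J)                 ≤⟨ +-monoˡ-≤ (t (suc J)) (sumBelow-≤-excess (suc J)) ⟩
      M + sumBelow (suc J) excess + t (suc J)         ≡⟨ +-assoc M (sumBelow (suc J) excess) (t (suc J)) ⟩
      M + (sumBelow (suc J) excess + excess (suc J))  ∎
      where open ≤-Reasoning

  sumBelow-terms-bound : ∀ J → p * p * sumBelow J t ≤ p * p * M + y * y * (e * M)
  sumBelow-terms-bound J = begin
    p * p * sumBelow J t                   ≤⟨ *-monoʳ-≤ (p * p) (sumBelow-≤-excess J) ⟩
    p * p * (M + sumBelow J excess)         ≡⟨ *-distribˡ-+ (p * p) M (sumBelow J excess) ⟩
    p * p * M + p * p * sumBelow J excess   ≤⟨ +-monoʳ-≤ (p * p * M) series ⟩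
    p * p * M + y * y * (e * M)            ∎
    where
    open ≤-Reasoning
    series : p * p * sumBelow J excess ≤ y * y * (e * M)
    series = derivedGeometric-bound p q (e * M) J excess p>0 (λ i _ → excess-bound i)

  step-inequality : ∀ s N J → StepCondition e s p q → s * M ≤ N + sumBelow J t → suc e * e * y * M ≤ q * N
  step-inequality s N J condition count =
    *-cancelˡ-≤ (p * p) {{>-nonZero (*-mono-≤ p>0 p>0)}} (+-cancelˡ-≤ W _ _ (begin
      W + p * p * (D * y * M)                               ≡⟨ expand q (p * p) M y e D ⟩
      (q * (p * p) + D * y * (p * p) + e * (y * y) * q) * M ≤⟨ *-monoˡ-≤ M condition ⟩
      s * q * (p * p) * M                                   ≡⟨ regroup s q (p * p) M ⟩
      q * (p * p * (s * M))                                 ≤⟨ *-monoʳ-≤ q (*-monoʳ-≤ (p * p) count) ⟩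
      q * (p * p * (N + sumBelow J t))                      ≡⟨ distrib q (p * p) N (sumBelow J t) ⟩
      q * (p * p * N) + q * (p * p * sumBelow J t)
        ≤⟨ +-monoʳ-≤ (q * (p * p * N)) (*-monoʳ-≤ q (sumBelow-terms-bound J)) ⟩
      q * (p * p * N) + q * (p * p * M + y * y * (e * M))   ≡⟨ regroup′ q (p * p) N M (y * y * (e * M)) ⟩
      W + p * p * (q * N)                                   ∎))
    where
    open ≤-Reasoning
    D W : ℕ
    D = suc e * e
    W = q * (p * p) * M + q * (y * y * (e * M))
    expand : ∀ q pp M y e D → q * pp * M + q * (y * y * (e * M)) + pp * (D * y * M)
                             ≡ (q * pp + D * y * pp + e * (y * y) * q) * M
    expand = solve-∀
    regroup : ∀ s q pp M → s * q * pp * M ≡ q * (pp * (s * M))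
    regroup = solve-∀
    distrib : ∀ q pp N S → q * (pp * (N + S)) ≡ q * (pp * N) + q * (pp * S)
    distrib = solve-∀
    regroup′ : ∀ q pp N M Z → q * (pp * N) + q * (pp * M + Z) ≡ q * pp * M + q * Z + pp * (q * N)
    regroup′ = solve-∀

-- 2Q³·P(a/Q) for P(x) = 1 + 3x/2 + x² + x³/2, as in ListSizeBound.
homP : ℕ → ℕ → ℕ
homP a Q = 2 * Q ^ 3 + 3 * a * Q ^ 2 + 2 * a ^ 2 * Q + a ^ 3

homP-gap : ℕ → ℕ → ℕ
homP-gap a Q = 3 * Q ^ 2 + 2 * Q * (2 * a + 1) + 3 * a ^ 2 + 3 * a + 1

homP-suc : ∀ a Q → homP (suc a) Q ≡ homP a Q + homP-gap a Q
homP-suc = solve 2 (λ a Q →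
  con 2 :* Q :^ 3 :+ con 3 :* (con 1 :+ a) :* Q :^ 2 :+ con 2 :* (con 1 :+ a) :^ 2 :* Q :+ (con 1 :+ a) :^ 3
  := con 2 :* Q :^ 3 :+ con 3 :* a :* Q :^ 2 :+ con 2 :* a :^ 2 :* Q :+ a :^ 3
     :+ (con 3 :* Q :^ 2 :+ con 2 :* Q :* (con 2 :* a :+ con 1) :+ con 3 :* a :^ 2 :+ con 3 :* a :+ con 1)) refl
  where open +-*-Solver

homP-gap-bound : ∀ a k → homP-gap a (suc a + k) ≤ 10 * (suc a + k) ^ 2
homP-gap-bound a k = ≤-trans (m≤m+n _ (5 * a + 10 * a * k + 4 + 12 * k + 7 * k ^ 2)) (≤-reflexive (identity a k))
  where
  open +-*-Solver
  identity : ∀ a k → homP-gap a (suc a + k) + (5 * a + 10 * a * k + 4 + 12 * k + 7 * k ^ 2) ≡ 10 * (suc a + k) ^ 2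
  identity = solve 2 (λ a k → let Q = con 1 :+ a :+ k in
    con 3 :* Q :^ 2 :+ con 2 :* Q :* (con 2 :* a :+ con 1) :+ con 3 :* a :^ 2 :+ con 3 :* a :+ con 1
      :+ (con 5 :* a :+ con 10 :* a :* k :+ con 4 :+ con 12 :* k :+ con 7 :* k :^ 2)
    := con 10 :* Q :^ 2) refl

homP-expansion : ∀ m k → let Q = m + k; p = m * (3 * Q + m); q = 3 * Q ^ 2 in
  32 * homP m Q * (q * (p * p))
  ≡ 32 * (2 * Q ^ 3 * ((p + q) * (p * p)) + m ^ 3 * ((p + q) * (p + q) * q)) + 5 * m ^ 3 * (q * (p * p))
    + (176 * m ^ 9 + 696 * m ^ 8 * k + 1017 * m ^ 7 * k ^ 2 + 650 * m ^ 6 * k ^ 3 + 153 * m ^ 5 * k ^ 4)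
homP-expansion = solve 2 (λ m k → let Q = m :+ k; p = m :* (con 3 :* Q :+ m); q = con 3 :* Q :^ 2 in
  con 32 :* (con 2 :* Q :^ 3 :+ con 3 :* m :* Q :^ 2 :+ con 2 :* m :^ 2 :* Q :+ m :^ 3) :* (q :* (p :* p))
  := con 32 :* (con 2 :* Q :^ 3 :* ((p :+ q) :* (p :* p)) :+ m :^ 3 :* ((p :+ q) :* (p :+ q) :* q))
     :+ con 5 :* m :^ 3 :* (q :* (p :* p))
     :+ (con 176 :* m :^ 9 :+ con 696 :* m :^ 8 :* k :+ con 1017 :* m :^ 7 :* k :^ 2
         :+ con 650 :* m :^ 6 :* k :^ 3 :+ con 153 :* m :^ 5 :* k :^ 4)) refl
  where open +-*-Solver

-- With t = m/Q the ratio p/q is t + t²/3, chosen so that the second-order terms of the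
-- expansion cancel; the remaining slack of order t³ absorbs the gap between m - 1 and m.
module Approximation (e m′ k : ℕ) where

  m Q p q : ℕ
  m = suc m′
  Q = m + k
  p = m * (3 * Q + m)
  q = 3 * Q ^ 2

  Q>0 : 0 < Q
  Q>0 = s≤s z≤n

  p>0 : 0 < p
  p>0 = *-mono-≤ {1} {m} (s≤s z≤n) (≤-trans (s≤s z≤n) (m≤n+m m (3 * Q)))

  q>0 : 0 < q
  q>0 = *-mono-≤ {1} {3} (s≤s z≤n) (^-monoˡ-≤ 2 Q>0)

  above-root : 2 * Q ^ 3 ≤ suc e * m ^ 3 → 2 * q ^ 3 ≤ suc e * p ^ 3
  above-root 2Q³≤Δm³ = begin
    2 * q ^ 3                      ≡⟨ split Q ⟩
    27 * Q ^ 3 * (2 * Q ^ 3)       ≤⟨ *-monoʳ-≤ (27 * Q ^ 3) 2Q³≤Δm³ ⟩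
    27 * Q ^ 3 * (suc e * m ^ 3)   ≡⟨ merge (suc e) m Q ⟩
    suc e * (m * (3 * Q)) ^ 3      ≤⟨ *-monoʳ-≤ (suc e) (^-monoˡ-≤ 3 (*-monoʳ-≤ m (m≤m+n (3 * Q) m))) ⟩
    suc e * p ^ 3                  ∎
    where
    open ≤-Reasoning
    open +-*-Solver
    split : ∀ Q → 2 * (3 * Q ^ 2) ^ 3 ≡ 27 * Q ^ 3 * (2 * Q ^ 3)
    split = solve 1 (λ Q → con 2 :* (con 3 :* Q :^ 2) :^ 3 := con 27 :* Q :^ 3 :* (con 2 :* Q :^ 3)) refl
    merge : ∀ Δ m Q → 27 * Q ^ 3 * (Δ * m ^ 3) ≡ Δ * (m * (3 * Q)) ^ 3
    merge = solve 3 (λ Δ m Q → con 27 :* Q :^ 3 :* (Δ :* m :^ 3) := Δ :* (m :* (con 3 :* Q)) :^ 3) refl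

  ratio-bound : 64 * Q ^ 2 ≤ m ^ 3 →
    2 * Q ^ 3 * ((p + q) * (p * p)) + m ^ 3 * ((p + q) * (p + q) * q) ≤ homP m′ Q * (q * (p * p))
  ratio-bound 64Q²≤m³ = *-cancelˡ-≤ 32 (+-cancelʳ-≤ (32 * (gap * X)) _ _ (begin
    32 * R + 32 * (gap * X)                ≡⟨ cong (32 * R +_) (sym (*-assoc 32 gap X)) ⟩
    32 * R + 32 * gap * X                  ≤⟨ +-monoʳ-≤ (32 * R) (*-monoˡ-≤ X 32gap≤5m³) ⟩
    32 * R + 5 * m ^ 3 * X                 ≤⟨ m≤m+n _ _ ⟩
    32 * R + 5 * m ^ 3 * X + _             ≡⟨ sym (homP-expansion m k) ⟩
    32 * homP m Q * X                      ≡⟨ cong (λ z → 32 * z * X) (homP-suc m′ Q) ⟩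
    32 * (homP m′ Q + gap) * X             ≡⟨ distrib (homP m′ Q) gap X ⟩
    32 * (homP m′ Q * X) + 32 * (gap * X)  ∎))
    where
    open ≤-Reasoning
    X R gap : ℕ
    X = q * (p * p)
    R = 2 * Q ^ 3 * ((p + q) * (p * p)) + m ^ 3 * ((p + q) * (p + q) * q)
    gap = homP-gap m′ Q
    32gap≤5m³ : 32 * gap ≤ 5 * m ^ 3
    32gap≤5m³ = begin
      32 * gap           ≤⟨ *-monoʳ-≤ 32 (homP-gap-bound m′ k) ⟩
      32 * (10 * Q ^ 2)  ≡⟨ regroup (Q ^ 2) ⟩
      5 * (64 * Q ^ 2)   ≤⟨ *-monoʳ-≤ 5 64Q²≤m³ ⟩
      5 * m ^ 3          ∎
      where
      regroup : ∀ x → 32 * (10 * x) ≡ 5 * (64 * x)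
      regroup = solve-∀
    distrib : ∀ a b x → 32 * (a + b) * x ≡ 32 * (a * x) + 32 * (b * x)
    distrib = solve-∀

  step-condition : ∀ s → 64 * Q ^ 2 ≤ m ^ 3 → 2 * Q ^ 3 ≤ suc e * m ^ 3 →
    2 * Q ^ 3 + suc e * e * homP m′ Q ≤ 2 * Q ^ 3 * s → StepCondition e s p q
  step-condition s 64Q²≤m³ 2Q³≤Δm³ list-bound = *-cancelˡ-≤ c {{>-nonZero c>0}} (begin
    c * (X + D * y * (p * p) + e * (y * y) * q)     ≡⟨ expand c X p q e Δ ⟩
    c * X + e * (Δ * (c * U)) + e * (c * V)         ≤⟨ +-monoʳ-≤ (c * X + e * (Δ * (c * U)))
                                                                (*-monoʳ-≤ e (*-monoˡ-≤ V 2Q³≤Δm³)) ⟩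
    c * X + e * (Δ * (c * U)) + e * (Δ * m ^ 3 * V) ≡⟨ collect c X e Δ U V (m ^ 3) ⟩
    c * X + D * (c * U + m ^ 3 * V)                ≤⟨ +-monoʳ-≤ (c * X) (*-monoʳ-≤ D (ratio-bound 64Q²≤m³)) ⟩
    c * X + D * (homP m′ Q * X)                    ≡⟨ factor c X D (homP m′ Q) ⟩
    (c + D * homP m′ Q) * X                        ≤⟨ *-monoˡ-≤ X list-bound ⟩
    c * s * X                                      ≡⟨ regroup c s q (p * p) ⟩
    c * (s * q * (p * p))                          ∎)
    where
    open ≤-Reasoning
    Δ D y c X U V : ℕ
    Δ = suc e
    D = Δ * e
    y = p + q
    c = 2 * Q ^ 3
    X = q * (p * p)
    U = y * (p * p)
    V = y * y * q
    c>0 : 0 < c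
    c>0 = *-mono-≤ {1} {2} (s≤s z≤n) (^-monoˡ-≤ 3 Q>0)
    expand : ∀ c X p q e Δ → c * (X + Δ * e * (p + q) * (p * p) + e * ((p + q) * (p + q)) * q)
                           ≡ c * X + e * (Δ * (c * ((p + q) * (p * p)))) + e * (c * ((p + q) * (p + q) * q))
    expand = solve-∀
    collect : ∀ c X e Δ U V M → c * X + e * (Δ * (c * U)) + e * (Δ * M * V) ≡ c * X + Δ * e * (c * U + M * V)
    collect = solve-∀
    factor : ∀ c X D W → c * X + D * (W * X) ≡ (c + D * W) * X
    factor = solve-∀
    regroup : ∀ c s q x → c * s * (q * x) ≡ c * (s * q * x)
    regroup = solve-∀

record GoodRatio (e : ℕ) : Set where
  field
    p q        : ℕ
    p>0        : 0 < p
    q>0        : 0 < q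
    above-root : 2 * q ^ 3 ≤ suc e * p ^ 3
    condition  : ∀ s → ListSizeBound (suc e) s → StepCondition e s p q

good-ratio-near : ∀ e m′ Q → suc m′ ≤ Q → 64 * Q ^ 2 ≤ suc m′ ^ 3 →
  2 * Q ^ 3 ≤ suc e * suc m′ ^ 3 → suc e * m′ ^ 3 < 2 * Q ^ 3 → GoodRatio e
good-ratio-near e m′ Q m≤Q 64Q²≤m³ 2Q³≤Δm³ Δm′³<2Q³ with m≤n⇒∃[o]m+o≡n m≤Q
... | k , refl = record
  { p = p ; q = q ; p>0 = p>0 ; q>0 = q>0 ; above-root = above-root 2Q³≤Δm³
  ; condition = λ s list-bound → step-condition s 64Q²≤m³ 2Q³≤Δm³ (list-bound m′ Q Q>0 Δm′³<2Q³)
  }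
  where open Approximation e m′ k using (p; q; Q>0; p>0; q>0; above-root; step-condition)

-- Q = 32Δ makes the grid 1/Q fine enough for Approximation.ratio-bound.
good-ratio : ∀ e → 1 ≤ e → GoodRatio e
good-ratio e e≥1 =
  let m′ , m′<Q , ¬above , above = crossing (λ m → 2 * Q ^ 3 ≤? Δ * m ^ 3) ¬above-at-0 above-at-Q
  in good-ratio-near e m′ Q m′<Q (*-cancelˡ-≤ Δ (≤-trans (≤-reflexive (sym (rescale Δ))) above))
                     above (≰⇒> ¬above)
  where
  open +-*-Solver
  Δ Q : ℕ
  Δ = suc e
  Q = 32 * Δ
  Q>0 : 0 < Q
  Q>0 = s≤s z≤n
  ¬above-at-0 : ¬ 2 * Q ^ 3 ≤ Δ * 0 ^ 3
  ¬above-at-0 le =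
    <⇒≱ (*-mono-≤ {1} {2} (s≤s z≤n) (^-monoˡ-≤ 3 Q>0)) (≤-trans le (≤-reflexive (*-zeroʳ Δ)))
  above-at-Q : 2 * Q ^ 3 ≤ Δ * Q ^ 3
  above-at-Q = *-monoˡ-≤ (Q ^ 3) (s≤s e≥1)
  rescale : ∀ Δ → 2 * (32 * Δ) ^ 3 ≡ Δ * (64 * (32 * Δ) ^ 2)
  rescale = solve 1 (λ Δ → con 2 :* (con 32 :* Δ) :^ 3 := Δ :* (con 64 :* (con 32 :* Δ) :^ 2)) refl

CountBound-from-ratio : ∀ e p q N M → 0 < q → 2 * q ^ 3 ≤ suc e * p ^ 3 →
  suc e * e * (p + q) * M ≤ q * N → CountBound (suc e) N M
CountBound-from-ratio e p q N M q>0 above-root DyM≤qN = X≤N , 2X³≤ΔZ³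
  where
  Δ X Z : ℕ
  Δ = suc e
  X = Δ * e * M
  Z = N ∸ X
  split : ∀ D p q M → D * (p + q) * M ≡ q * (D * M) + p * (D * M)
  split = solve-∀
  qX+pX≤qN : q * X + p * X ≤ q * N
  qX+pX≤qN = subst (_≤ q * N) (split (Δ * e) p q M) DyM≤qN
  X≤N : X ≤ N
  X≤N = *-cancelˡ-≤ q {{>-nonZero q>0}} (≤-trans (m≤m+n (q * X) (p * X)) qX+pX≤qN)
  pX≤qZ : p * X ≤ q * Z
  pX≤qZ = +-cancelˡ-≤ (q * X) _ _ (begin
    q * X + p * X    ≤⟨ qX+pX≤qN ⟩
    q * N            ≡⟨ cong (q *_) (sym (m+[n∸m]≡n X≤N)) ⟩
    q * (X + Z)      ≡⟨ *-distribˡ-+ q X Z ⟩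
    q * X + q * Z    ∎)
    where open ≤-Reasoning
  2X³≤ΔZ³ : 2 * X ^ 3 ≤ Δ * Z ^ 3
  2X³≤ΔZ³ = *-cancelˡ-≤ (q ^ 3) {{m^n≢0 q 3 {{>-nonZero q>0}}}} (begin
    q ^ 3 * (2 * X ^ 3)  ≡⟨ regroup (q ^ 3) (X ^ 3) ⟩
    2 * q ^ 3 * X ^ 3    ≤⟨ *-monoˡ-≤ (X ^ 3) above-root ⟩
    Δ * p ^ 3 * X ^ 3    ≡⟨ cube-product Δ p X ⟩
    Δ * (p * X) ^ 3      ≤⟨ *-monoʳ-≤ Δ (^-monoˡ-≤ 3 pX≤qZ) ⟩
    Δ * (q * Z) ^ 3      ≡⟨ cube-product′ Δ q Z ⟩
    q ^ 3 * (Δ * Z ^ 3)  ∎)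
    where
    open ≤-Reasoning
    open +-*-Solver
    regroup : ∀ c x → c * (2 * x) ≡ 2 * c * x
    regroup = solve-∀
    cube-product : ∀ Δ p X → Δ * p ^ 3 * X ^ 3 ≡ Δ * (p * X) ^ 3
    cube-product = solve 3 (λ Δ p X → Δ :* p :^ 3 :* X :^ 3 := Δ :* (p :* X) :^ 3) refl
    cube-product′ : ∀ Δ q Z → Δ * (q * Z) ^ 3 ≡ q ^ 3 * (Δ * Z ^ 3)
    cube-product′ = solve 3 (λ Δ q Z → Δ :* (q :* Z) :^ 3 := q :^ 3 :* (Δ :* Z :^ 3)) refl

-- Lists

injection⇒length≤ : DecidableEquality B → (f : A → B) {xs : List A} {ys : List B} → Unique xs →
  (∀ {x} → x ∈ xs → f x ∈ ys) → (∀ {x y} → x ∈ xs → y ∈ xs → f x ≡ f y → x ≡ y) →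
  length xs ≤ length ys
injection⇒length≤ _≟_ f {[]} _ _ _ = z≤n
injection⇒length≤ _≟_ f {x ∷ xs} {ys} (x∉xs ∷ xs!) maps inj =
  ≤-trans (s≤s (injection⇒length≤ _≟_ f xs! maps′ (λ p q → inj (there p) (there q))))
          (filter-notAll (λ z → ¬? (z ≟ f x)) ys
                         (Any.map (λ fx≡z z≢fx → z≢fx (sym fx≡z)) (maps (here refl))))
  where
  maps′ : ∀ {y} → y ∈ xs → f y ∈ filter (λ z → ¬? (z ≟ f x)) ys
  maps′ y∈xs = ∈-filter⁺ (λ z → ¬? (z ≟ f x)) (maps (there y∈xs))
                 (λ fy≡fx → All.lookup x∉xs y∈xs (sym (inj (there y∈xs) (here refl) fy≡fx)))

length-concatMap-≤ : ∀ (f : A → List B) xs {K} → (∀ {x} → x ∈ xs → length (f x) ≤ K) →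
  length (concatMap f xs) ≤ length xs * K
length-concatMap-≤ f [] _ = z≤n
length-concatMap-≤ f (x ∷ xs) bound =
  ≤-trans (≤-reflexive (length-++ (f x))) (+-mono-≤ (bound (here refl)) (length-concatMap-≤ f xs (bound ∘ there)))

scaled-length-concatMap-≤ : ∀ (f : A → List B) xs {a b} → (∀ {x} → x ∈ xs → a * length (f x) ≤ b) →
  a * length (concatMap f xs) ≤ length xs * b
scaled-length-concatMap-≤ f [] {a} _ = ≤-reflexive (*-zeroʳ a)
scaled-length-concatMap-≤ f (x ∷ xs) {a} {b} bound = begin
  a * length (f x ++ concatMap f xs)            ≡⟨ cong (a *_) (length-++ (f x)) ⟩
  a * (length (f x) + length (concatMap f xs))  ≡⟨ *-distribˡ-+ a (length (f x)) _ ⟩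
  a * length (f x) + a * length (concatMap f xs)
    ≤⟨ +-mono-≤ (bound (here refl)) (scaled-length-concatMap-≤ f xs {a} (bound ∘ there)) ⟩
  b + length xs * b                             ∎
  where open ≤-Reasoning

∈-concatMap-intro : ∀ {f : A → List B} {xs x y} → x ∈ xs → y ∈ f x → y ∈ concatMap f xs
∈-concatMap-intro {f = f} x∈xs y∈fx = ∈-concatMap⁺ f (Any.map (λ { refl → y∈fx }) x∈xs)

length-cartesianProduct : ∀ (xs : List A) (ys : List B) → length (cartesianProduct xs ys) ≡ length xs * length ys
length-cartesianProduct [] ys = refl
length-cartesianProduct (x ∷ xs) ys =
  trans (length-++ (map (x ,_) ys)) (cong₂ _+_ (length-map (x ,_) ys) (length-cartesianProduct xs ys))

concatBelow : ℕ → (ℕ → List A) → List A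
concatBelow zero f = []
concatBelow (suc J) f = concatBelow J f ++ f J

∈-concatBelow : ∀ {J i} (f : ℕ → List A) {x} → i < J → x ∈ f i → x ∈ concatBelow J f
∈-concatBelow {J = suc J} {i} f i<1+J x∈fi with m≤n⇒m<n∨m≡n (≤-pred i<1+J)
... | inj₁ i<J = ∈-++⁺ˡ (∈-concatBelow f i<J x∈fi)
... | inj₂ refl = ∈-++⁺ʳ (concatBelow i f) x∈fi

length-concatBelow : ∀ J (f : ℕ → List A) → length (concatBelow J f) ≡ sumBelow J (length ∘ f)
length-concatBelow zero f = refl
length-concatBelow (suc J) f =
  trans (length-++ (concatBelow J f)) (cong (_+ length (f J)) (length-concatBelow J f))

take-length-++ : ∀ (xs ys : List A) → take (length xs) (xs ++ ys) ≡ xs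
take-length-++ [] ys = refl
take-length-++ (x ∷ xs) ys = cong (x ∷_) (take-length-++ xs ys)

drop-length-++ : ∀ (xs ys : List A) → drop (length xs) (xs ++ ys) ≡ ys
drop-length-++ [] ys = refl
drop-length-++ (x ∷ xs) ys = drop-length-++ xs ys

∈-drop⁻ : ∀ {x : A} k xs → x ∈ drop k xs → x ∈ xs
∈-drop⁻ k xs x∈ = subst (_ ∈_) (take++drop≡id k xs) (∈-++⁺ʳ (take k xs) x∈)

∈-take⁻ : ∀ {x : A} k xs → x ∈ take k xs → x ∈ xs
∈-take⁻ k xs x∈ = subst (_ ∈_) (take++drop≡id k xs) (∈-++⁺ˡ x∈)

module _ (xs : List A) {j} (len≡ : length xs ≡ j + j) where

  length-take-half : length (take j xs) ≡ j
  length-take-half = trans (length-take j xs) (m≤n⇒m⊓n≡m (subst (j ≤_) (sym len≡) (m≤m+n j j)))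

  length-drop-half : length (drop j xs) ≡ j
  length-drop-half = trans (length-drop j xs) (trans (cong (_∸ j) len≡) (m+n∸m≡n j j))

  reverse-halves : take j (reverse xs) ≡ reverse (drop j xs) × drop j (reverse xs) ≡ reverse (take j xs)
  reverse-halves =
    subst (λ zs → take j zs ≡ reverse (drop j xs) × drop j zs ≡ reverse (take j xs)) (sym reverse-split)
      (halves (trans (length-reverse (drop j xs)) length-drop-half))
    where
    reverse-split : reverse xs ≡ reverse (drop j xs) ++ reverse (take j xs)
    reverse-split = trans (cong reverse (sym (take++drop≡id j xs))) (reverse-++ (take j xs) (drop j xs))
    halves : ∀ {ys zs : List A} → length ys ≡ j → take j (ys ++ zs) ≡ ys × drop j (ys ++ zs) ≡ zs
    halves {ys} {zs} refl = take-length-++ ys zs , drop-length-++ ys zs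

∈-take-reverse : ∀ {x : A} {j} xs → length xs ≡ j + j → x ∈ xs → x ∉ take j xs → x ∈ take j (reverse xs)
∈-take-reverse {x = x} {j} xs len≡ x∈ x∉front
  with ∈-++⁻ (take j xs) (subst (x ∈_) (sym (take++drop≡id j xs)) x∈)
... | inj₁ x∈front = ⊥-elim (x∉front x∈front)
... | inj₂ x∈back = subst (x ∈_) (sym (proj₁ (reverse-halves xs len≡))) (Any.reverse⁺ x∈back)

split-around : ∀ {x : A} {i} xs → length xs ≡ suc i + suc i → x ∈ take (suc i) xs →
  ∃[ pre ] ∃[ y ] ∃[ rest ] xs ≡ pre ++ x ∷ y ∷ rest × length pre ≤ i
split-around {x = x} {i} xs len≡ x∈ with ∈-∃++ x∈
... | pre , mid , take≡ with mid ++ drop (suc i) xs in post≡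
...   | [] = ⊥-elim (drop-nonempty (++-conicalʳ mid (drop (suc i) xs) post≡))
  where
  drop-nonempty : drop (suc i) xs ≢ []
  drop-nonempty eq = 0≢1+n (trans (sym (cong length eq)) (length-drop-half xs len≡))
...   | y ∷ rest = pre , y , rest , xs≡ , ≤-pred pre<
  where
  xs≡ : xs ≡ pre ++ x ∷ y ∷ rest
  xs≡ = begin
    xs                                  ≡⟨ take++drop≡id (suc i) xs ⟨
    take (suc i) xs ++ drop (suc i) xs  ≡⟨ cong (_++ drop (suc i) xs) take≡ ⟩
    (pre ++ x ∷ mid) ++ drop (suc i) xs ≡⟨ ++-assoc pre (x ∷ mid) (drop (suc i) xs) ⟩
    pre ++ x ∷ (mid ++ drop (suc i) xs) ≡⟨ cong (λ zs → pre ++ x ∷ zs) post≡ ⟩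
    pre ++ x ∷ y ∷ rest                 ∎
    where open ≡-Reasoning
  pre< : length pre < suc i
  pre< = begin-strict
    length pre                  <⟨ m<m+n (length pre) (s≤s z≤n) ⟩
    length pre + length (x ∷ mid) ≡⟨ length-++ pre ⟨
    length (pre ++ x ∷ mid)      ≡⟨ cong length take≡ ⟨
    length (take (suc i) xs)     ≡⟨ length-take-half xs len≡ ⟩
    suc i                        ∎
    where open ≤-Reasoning

reverse-∷-++ : ∀ (x : A) xs ys → reverse (x ∷ xs) ++ ys ≡ reverse xs ++ x ∷ ys
reverse-∷-++ x xs ys = trans (cong (_++ ys) (unfold-reverse x xs)) (++-assoc (reverse xs) [ x ] ys)

module _ {R : A → A → Set} where

  Linked-drop : ∀ k {xs} → Linked R xs → Linked R (drop k xs)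
  Linked-drop zero l = l
  Linked-drop (suc k) {[]} l = []
  Linked-drop (suc k) {x ∷ xs} l = Linked-drop k (Linked.tail l)

  Linked-take : ∀ k {xs} → Linked R xs → Linked R (take k xs)
  Linked-take zero l = []
  Linked-take (suc k) {[]} l = []
  Linked-take (suc zero) {x ∷ xs} l = [-]
  Linked-take (suc (suc k)) {x ∷ []} l = [-]
  Linked-take (suc (suc k)) {x ∷ y ∷ xs} (r ∷ l) = r ∷ Linked-take (suc k) l

  Linked-++ʳ : ∀ xs {ys} → Linked R (xs ++ ys) → Linked R ys
  Linked-++ʳ [] l = l
  Linked-++ʳ (x ∷ xs) l = Linked-++ʳ xs (Linked.tail l)

  Linked-reverse : (∀ {a b} → R a b → R b a) → ∀ {xs} → Linked R xs → Linked R (reverse xs)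
  Linked-reverse R-sym {[]} l = []
  Linked-reverse R-sym {x ∷ xs} l =
    subst (Linked R) (++-identityʳ (reverse (x ∷ xs))) (reverse-onto x xs [] l [-])
    where
    reverse-onto : ∀ x xs acc → Linked R (x ∷ xs) → Linked R (x ∷ acc) → Linked R (reverse (x ∷ xs) ++ acc)
    reverse-onto x [] acc l la = la
    reverse-onto x (y ∷ xs) acc (r ∷ l) la =
      subst (Linked R) (sym (reverse-∷-++ x (y ∷ xs) acc)) (reverse-onto y xs (x ∷ acc) l (R-sym r ∷ la))

Unique-++ʳ : ∀ (xs : List A) {ys} → Unique (xs ++ ys) → Unique ys
Unique-++ʳ [] u = u
Unique-++ʳ (x ∷ xs) (_ ∷ u) = Unique-++ʳ xs u

Unique-reverse : ∀ {xs : List A} → Unique xs → Unique (reverse xs)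
Unique-reverse {xs = []} u = []
Unique-reverse {xs = x ∷ xs} (x∉xs ∷ u) =
  subst Unique (sym (unfold-reverse x xs))
    (Unique.++⁺ (Unique-reverse u) ([] ∷ [])
      (λ { (x∈ , here refl) → All.lookup x∉xs (Any.reverse⁻ x∈) refl }))

Unique-++-disjoint : ∀ (xs : List A) {ys w} → Unique (xs ++ ys) → w ∈ ys → w ∉ xs
Unique-++-disjoint (x ∷ xs) (x∉ ∷ u) w∈ys (here refl) = All.lookup x∉ (∈-++⁺ʳ xs w∈ys) refl
Unique-++-disjoint (x ∷ xs) (x∉ ∷ u) w∈ys (there w∈xs) = Unique-++-disjoint xs u w∈ys w∈xs

∈-++-insert : ∀ (xs : List A) {y ys z} → z ∈ xs ++ ys → z ∈ xs ++ y ∷ ys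
∈-++-insert xs z∈ with ∈-++⁻ xs z∈
... | inj₁ z∈xs = ∈-++⁺ˡ z∈xs
... | inj₂ z∈ys = ∈-++⁺ʳ xs (there z∈ys)

Unique-remove : ∀ (xs : List A) {y ys} → Unique (xs ++ y ∷ ys) → Unique (xs ++ ys) × y ∉ xs ++ ys
Unique-remove [] (y∉ys ∷ ys!) = ys! , λ y∈ys → All.lookup y∉ys y∈ys refl
Unique-remove (x ∷ xs) {y} {ys} (x∉ ∷ rest!) with Unique-remove xs rest!
... | rest′! , y∉rest = All.tabulate (λ z∈ → All.lookup x∉ (∈-++-insert xs z∈)) ∷ rest′! , y∉
  where
  y∉ : y ∉ x ∷ xs ++ ys
  y∉ (here refl) = All.lookup x∉ (∈-++⁺ʳ xs (here refl)) refl
  y∉ (there y∈) = y∉rest y∈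

partner : ∀ (xs ys : List A) {u} → u ∈ xs → length xs ≡ length ys →
  ∃[ w ] w ∈ ys × (∀ (f : A → B) → map f xs ≡ map f ys → f u ≡ f w)
partner (x ∷ xs) (y ∷ ys) (here refl) _ = y , here refl , λ f eq → ∷-injectiveˡ eq
partner (x ∷ xs) (y ∷ ys) (there u∈xs) len with partner xs ys u∈xs (suc-injective len)
... | w , w∈ys , same = w , there w∈ys , λ f eq → same f (∷-injectiveʳ eq)

[]≔-injective : ∀ {n} {c₁ c₂ : Vec ℕ n} {v x₁ x₂} → lookup c₁ v ≡ lookup c₂ v →
  c₁ [ v ]≔ x₁ ≡ c₂ [ v ]≔ x₂ → x₁ ≡ x₂ × c₁ ≡ c₂
[]≔-injective {c₁ = c₁} {c₂} {v} {x₁} {x₂} same-at-v eq =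
  trans (sym (lookup∘update v c₁ x₁)) (trans (cong (λ c → lookup c v) eq) (lookup∘update v c₂ x₂)) ,
  Pointwise-≡⇒≡ (ext agree)
  where
  agree : ∀ u → lookup c₁ u ≡ lookup c₂ u
  agree u with u ≟ v
  ... | yes refl = same-at-v
  ... | no u≢v =
    trans (sym (lookup∘update′ u≢v c₁ x₁)) (trans (cong (λ c → lookup c u) eq) (lookup∘update′ u≢v c₂ x₂))

-- Paths and repetitions

module _ {n} (G : Graph n) where

  Adj : Fin n → Fin n → Set
  Adj a b = T (adj G a b)

  Adj-sym : ∀ {a b} → Adj a b → Adj b a
  Adj-sym {a} {b} = subst T (Graph.sym G a b)

  isPath? : ∀ ps → Dec (IsPath G ps)
  isPath? ps = allPairs? (λ x y → ¬? (x ≟ y)) ps ×-dec linked? (λ x y → T? (adj G x y)) ps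

  IsPath-take : ∀ k {ps} → IsPath G ps → IsPath G (take k ps)
  IsPath-take k (u , l) = Unique.take⁺ k u , Linked-take k l

  IsPath-drop : ∀ k {ps} → IsPath G ps → IsPath G (drop k ps)
  IsPath-drop k (u , l) = Unique.drop⁺ k u , Linked-drop k l

  IsPath-++ʳ : ∀ xs {ys} → IsPath G (xs ++ ys) → IsPath G ys
  IsPath-++ʳ xs (u , l) = Unique-++ʳ xs u , Linked-++ʳ xs l

  IsPath-reverse : ∀ {ps} → IsPath G ps → IsPath G (reverse ps)
  IsPath-reverse (u , l) = Unique-reverse u , Linked-reverse Adj-sym l

Unique⇒length≤ : ∀ {n} {xs : List (Fin n)} → Unique xs → length xs ≤ n
Unique⇒length≤ {n} {xs} u = subst (length xs ≤_) (length-tabulate id)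
  (injection⇒length≤ _≟_ id u (λ {x} _ → ∈-allFin x) (λ _ _ eq → eq))

listsUpTo : ∀ {n} → ℕ → List (List (Fin n))
listsUpTo zero = [ [] ]
listsUpTo {n} (suc k) = [] ∷ concatMap (λ x → map (x ∷_) (listsUpTo k)) (allFin n)

∈-listsUpTo : ∀ {n} k (xs : List (Fin n)) → length xs ≤ k → xs ∈ listsUpTo k
∈-listsUpTo zero [] _ = here refl
∈-listsUpTo (suc k) [] _ = here refl
∈-listsUpTo (suc k) (x ∷ xs) (s≤s len≤k) =
  there (∈-concatMap-intro (∈-allFin x) (∈-map⁺ (x ∷_) (∈-listsUpTo k xs len≤k)))

HalvesMatch : ℕ → List ℕ → Set
HalvesMatch i s = length s ≡ suc i + suc i × take (suc i) s ≡ drop (suc i) s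

halvesMatch? : ∀ i s → Dec (HalvesMatch i s)
halvesMatch? i s = (length s ≟ℕ suc i + suc i) ×-dec ≡-decList _≟ℕ_ (take (suc i) s) (drop (suc i) s)

IsSquare⇒HalvesMatch : ∀ {s} → IsSquare s → ∃[ i ] HalvesMatch i s
IsSquare⇒HalvesMatch (x ∷ u , _ , refl) =
  length u , length-++ (x ∷ u) , trans (take-length-++ (x ∷ u) (x ∷ u)) (sym (drop-length-++ (x ∷ u) (x ∷ u)))
IsSquare⇒HalvesMatch ([] , []≢[] , _) = ⊥-elim ([]≢[] refl)

HalvesMatch⇒IsSquare : ∀ {i s} → HalvesMatch i s → IsSquare s
HalvesMatch⇒IsSquare {i} {s} (len≡ , halves≡) = take (suc i) s , nonempty s len≡ ,
  trans (sym (take++drop≡id (suc i) s)) (cong (take (suc i) s ++_) (sym halves≡))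
  where
  nonempty : ∀ s → length s ≡ suc i + suc i → take (suc i) s ≢ []
  nonempty (_ ∷ _) _ ()

HalvesMatch-reverse : ∀ {i s} → HalvesMatch i s → HalvesMatch i (reverse s)
HalvesMatch-reverse {i} {s} (len≡ , halves≡) with reverse-halves s len≡
... | take≡ , drop≡ = trans (length-reverse s) len≡ , trans take≡ (trans (cong reverse (sym halves≡)) (sym drop≡))

module _ {n} (G : Graph n) (c : Vec ℕ n) where

  NoRepetitivePath : Set
  NoRepetitivePath = ∀ i ps → IsPath G ps → ¬ HalvesMatch i (map (lookup c) ps)

  NonRep⇒NoRepetitivePath : NonRepColoring G c → NoRepetitivePath
  NonRep⇒NoRepetitivePath nonrep i ps path halves =
    nonrep ps path ([] , _ , [] , sym (++-identityʳ _) , HalvesMatch⇒IsSquare halves)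

  -- A square factor w of the colours along ps is the colour sequence of a subpath.
  NoRepetitivePath⇒NonRep : NoRepetitivePath → NonRepColoring G c
  NoRepetitivePath⇒NonRep none ps path (a , w , b , colours≡ , square) with IsSquare⇒HalvesMatch square
  ... | i , halves = none i subpath (IsPath-take G (length w) (IsPath-drop G (length a) path))
                       (subst (HalvesMatch i) (sym colours-of-subpath) halves)
    where
    subpath : List (Fin n)
    subpath = take (length w) (drop (length a) ps)
    colours-of-subpath : map (lookup c) subpath ≡ w
    colours-of-subpath = begin
      map (lookup c) (take (length w) (drop (length a) ps)) ≡⟨ take-map (length w) (drop (length a) ps) ⟨
      take (length w) (map (lookup c) (drop (length a) ps)) ≡⟨ cong (take (length w)) (drop-map (length a) ps) ⟨
      take (length w) (drop (length a) (map (lookup c) ps))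
        ≡⟨ cong (λ s → take (length w) (drop (length a) s)) colours≡ ⟩
      take (length w) (drop (length a) (a ++ w ++ b))       ≡⟨ cong (take (length w)) (drop-length-++ a (w ++ b)) ⟩
      take (length w) (w ++ b)                              ≡⟨ take-length-++ w b ⟩
      w                                                     ∎
      where open ≡-Reasoning

-- Counting candidate paths

module Candidates {n} (G : Graph n) (e : ℕ) (deg : MaxDegreeAtMost G (suc e)) where

  neighbours : Fin n → List (Fin n)
  neighbours c = filter (λ x → T? (adj G c x)) (allFin n)

  ∈-neighbours : ∀ {c x} → Adj G c x → x ∈ neighbours c
  ∈-neighbours {c} {x} = ∈-filter⁺ (λ x → T? (adj G c x)) (∈-allFin x)

  length-neighbours : ∀ c → length (neighbours c) ≤ suc e
  length-neighbours c = subst (_≤ suc e) (sym (count (adj G c) (allFin n))) (deg c)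
    where
    count : ∀ (f : Fin n → Bool) xs →
            length (filter (λ x → T? (f x)) xs) ≡ sum (map (λ w → if f w then 1 else 0) xs)
    count f [] = refl
    count f (x ∷ xs) with f x
    ... | true = cong suc (count f xs)
    ... | false = count f xs

  onwards : Fin n → Fin n → List (Fin n)
  onwards p c = filter (λ x → ¬? (x ≟ p)) (neighbours c)

  length-onwards : ∀ {p c} → Adj G c p → length (onwards p c) ≤ e
  length-onwards {p} {c} c~p = ≤-pred (≤-trans
    (filter-notAll (λ x → ¬? (x ≟ p)) (neighbours c) (Any.map (λ p≡x x≢p → x≢p (sym p≡x)) (∈-neighbours c~p)))
    (length-neighbours c))

  nonBacktrackingWalks : Fin n → Fin n → ℕ → List (List (Fin n))
  nonBacktrackingWalks p c zero = [ [] ]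
  nonBacktrackingWalks p c (suc k) = concatMap (λ x → map (x ∷_) (nonBacktrackingWalks c x k)) (onwards p c)

  length-nonBacktrackingWalks : ∀ {p c} k → Adj G c p → length (nonBacktrackingWalks p c k) ≤ e ^ k
  length-nonBacktrackingWalks zero _ = ≤-refl
  length-nonBacktrackingWalks {p} {c} (suc k) c~p = ≤-trans
    (length-concatMap-≤ (λ x → map (x ∷_) (nonBacktrackingWalks c x k)) (onwards p c) (λ {x} x∈ →
      ≤-trans (≤-reflexive (length-map (x ∷_) (nonBacktrackingWalks c x k)))
              (length-nonBacktrackingWalks k (Adj-sym G (proj₂ (∈-filter⁻ (λ x → T? (adj G c x)) {xs = allFin n}
                                                   (proj₁ (∈-filter⁻ (λ x → ¬? (x ≟ p)) x∈))))))))
    (*-monoˡ-≤ (e ^ k) (length-onwards c~p))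

  ∈-nonBacktrackingWalks : ∀ {p c} xs → IsPath G (p ∷ c ∷ xs) → xs ∈ nonBacktrackingWalks p c (length xs)
  ∈-nonBacktrackingWalks [] _ = here refl
  ∈-nonBacktrackingWalks {p} {c} (x ∷ xs) ((p∉ ∷ c∉ ∷ u) , (_ ∷ c~x ∷ l)) =
    ∈-concatMap-intro (∈-filter⁺ (λ x → ¬? (x ≟ p)) (∈-neighbours c~x) x≢p)
                      (∈-map⁺ (x ∷_) (∈-nonBacktrackingWalks xs ((c∉ ∷ u) , (c~x ∷ l))))
    where
    x≢p : x ≢ p
    x≢p x≡p = All.lookup p∉ (there (here (sym x≡p))) refl

  -- Lists pre ++ v ∷ y ∷ rest with |pre| = a, |rest| = r, where reverse pre and rest are
  -- non-backtracking walks leaving the edge v y at either end.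
  around : Fin n → ℕ → ℕ → List (List (Fin n))
  around v a r =
    concatMap (λ y → concatMap (λ rest → map (λ bk → reverse bk ++ v ∷ y ∷ rest) (nonBacktrackingWalks y v a))
                               (nonBacktrackingWalks v y r))
              (neighbours v)

  length-around : ∀ v a r → length (around v a r) ≤ suc e * (e ^ r * e ^ a)
  length-around v a r = ≤-trans
    (length-concatMap-≤ _ (neighbours v) (λ {y} y∈ → ≤-trans
      (length-concatMap-≤ _ (nonBacktrackingWalks v y r) (λ {rest} _ →
        ≤-trans (≤-reflexive (length-map (λ bk → reverse bk ++ v ∷ y ∷ rest) (nonBacktrackingWalks y v a)))
                (length-nonBacktrackingWalks a (adjacent y∈))))
      (*-monoˡ-≤ (e ^ a) (length-nonBacktrackingWalks r (Adj-sym G (adjacent y∈))))))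
    (*-monoˡ-≤ (e ^ r * e ^ a) (length-neighbours v))
    where
    adjacent : ∀ {y} → y ∈ neighbours v → Adj G v y
    adjacent = proj₂ ∘ ∈-filter⁻ (λ x → T? (adj G v x)) {xs = allFin n}

  ∈-around : ∀ {v y} pre rest → IsPath G (pre ++ v ∷ y ∷ rest) →
    pre ++ v ∷ y ∷ rest ∈ around v (length pre) (length rest)
  ∈-around {v} {y} pre rest path =
    ∈-concatMap-intro (∈-neighbours v~y) (∈-concatMap-intro rest∈
      (subst (λ bk → bk ++ v ∷ y ∷ rest ∈ map (λ bk → reverse bk ++ v ∷ y ∷ rest)
                                               (nonBacktrackingWalks y v (length pre)))
             (reverse-involutive pre)
             (∈-map⁺ (λ bk → reverse bk ++ v ∷ y ∷ rest) pre∈)))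
    where
    forward : IsPath G (v ∷ y ∷ rest)
    forward = IsPath-++ʳ G pre path
    v~y : Adj G v y
    v~y with forward
    ... | _ , (v~y ∷ _) = v~y
    rest∈ : rest ∈ nonBacktrackingWalks v y (length rest)
    rest∈ = ∈-nonBacktrackingWalks rest forward
    backward : IsPath G (y ∷ v ∷ reverse pre)
    backward = IsPath-++ʳ G (reverse rest) (subst (IsPath G) reversed (IsPath-reverse G path))
      where
      reversed : reverse (pre ++ v ∷ y ∷ rest) ≡ reverse rest ++ y ∷ v ∷ reverse pre
      reversed = begin
        reverse (pre ++ v ∷ y ∷ rest)           ≡⟨ reverse-++ pre (v ∷ y ∷ rest) ⟩
        reverse (v ∷ y ∷ rest) ++ reverse pre   ≡⟨ reverse-∷-++ v (y ∷ rest) (reverse pre) ⟩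
        reverse (y ∷ rest) ++ v ∷ reverse pre   ≡⟨ reverse-∷-++ y rest (v ∷ reverse pre) ⟩
        reverse rest ++ y ∷ v ∷ reverse pre     ∎
        where open ≡-Reasoning
    pre∈ : reverse pre ∈ nonBacktrackingWalks y v (length pre)
    pre∈ = subst (λ k → reverse pre ∈ nonBacktrackingWalks y v k) (length-reverse pre)
                 (∈-nonBacktrackingWalks (reverse pre) backward)

  -- Contains every path on 2(i + 1) vertices having v among its first i + 1 vertices.
  candidates : Fin n → ℕ → List (List (Fin n))
  candidates v i = concatMap (λ a → around v a (i + i ∸ a)) (upTo (suc i))

  length-candidates : ∀ v i → length (candidates v i) ≤ suc i * (suc e * e ^ (i + i))
  length-candidates v i = ≤-trans
    (length-concatMap-≤ (λ a → around v a (i + i ∸ a)) (upTo (suc i)) (λ {a} a∈ →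
      ≤-trans (length-around v a (i + i ∸ a))
              (≤-reflexive (cong (suc e *_) (powers (≤-trans (≤-pred (∈-upTo⁻ a∈)) (m≤m+n i i)))))))
    (≤-reflexive (cong (_* (suc e * e ^ (i + i))) (length-upTo (suc i))))
    where
    powers : ∀ {a} → a ≤ i + i → e ^ (i + i ∸ a) * e ^ a ≡ e ^ (i + i)
    powers {a} a≤ = trans (sym (^-distribˡ-+-* e (i + i ∸ a) a)) (cong (e ^_) (m∸n+n≡m a≤))

  ∈-candidates : ∀ {v i ps} → IsPath G ps → length ps ≡ suc i + suc i → v ∈ take (suc i) ps →
    ps ∈ candidates v i
  ∈-candidates {v} {i} {ps} path len≡ v∈ with split-around ps len≡ v∈
  ... | pre , y , rest , refl , pre≤i =
    ∈-concatMap-intro (∈-upTo⁺ (s≤s pre≤i))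
      (subst (λ r → ps ∈ around v (length pre) r) rest-length (∈-around pre rest path))
    where
    rest-length : length rest ≡ i + i ∸ length pre
    rest-length = begin
      length rest                            ≡⟨ m+n∸m≡n (length pre) (length rest) ⟨
      length pre + length rest ∸ length pre  ≡⟨ cong (_∸ length pre) total ⟩
      i + i ∸ length pre                     ∎
      where
      open ≡-Reasoning
      total : length pre + length rest ≡ i + i
      total = suc-injective (suc-injective (begin
        suc (suc (length pre + length rest)) ≡⟨ cong suc (+-suc (length pre) (length rest)) ⟨
        suc (length pre + suc (length rest)) ≡⟨ +-suc (length pre) (suc (length rest)) ⟨
        length pre + length (v ∷ y ∷ rest)   ≡⟨ length-++ pre ⟨
        length ps                            ≡⟨ len≡ ⟩
        suc i + suc i                        ≡⟨ cong suc (+-suc i i) ⟩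
        suc (suc (i + i))                    ∎))

-- Partial colourings

x∈p─q⇒x∉q : ∀ {x : Fin n} (p q : Subset n) → x ∈ₛ p ─ q → x ∉ₛ q
x∈p─q⇒x∉q (_ ∷ p) (inside ∷ q) (there x∈) (there x∈q) = x∈p─q⇒x∉q p q x∈ x∈q
x∈p─q⇒x∉q (_ ∷ p) (outside ∷ q) here ()
x∈p─q⇒x∉q (_ ∷ p) (outside ∷ q) (there x∈) (there x∈q) = x∈p─q⇒x∉q p q x∈ x∈q

x∈p-y⇒x≢y : ∀ {x y : Fin n} (p : Subset n) → x ∈ₛ p - y → x ≢ y
x∈p-y⇒x≢y {x = x} p x∈ refl = x∈p─q⇒x∉q p ⁅ x ⁆ x∈ (x∈⁅x⁆ x)

infixl 5 _∖_
_∖_ : Subset n → List (Fin n) → Subset n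
S ∖ [] = S
S ∖ (x ∷ xs) = (S - x) ∖ xs

∖-⊆ : ∀ (S : Subset n) xs → S ∖ xs ⊆ S
∖-⊆ S [] u∈ = u∈
∖-⊆ S (x ∷ xs) u∈ = p─q⊆p S ⁅ x ⁆ (∖-⊆ (S - x) xs u∈)

∈-∖⁻ : ∀ {u} (S : Subset n) xs → u ∈ₛ S ∖ xs → u ∉ xs
∈-∖⁻ S (x ∷ xs) u∈ (here refl) = x∈p-y⇒x≢y S (∖-⊆ (S - x) xs u∈) refl
∈-∖⁻ S (x ∷ xs) u∈ (there u∈xs) = ∈-∖⁻ (S - x) xs u∈ u∈xs

∈-∖⁺ : ∀ {u} (S : Subset n) xs → u ∈ₛ S → u ∉ xs → u ∈ₛ S ∖ xs
∈-∖⁺ S [] u∈ _ = u∈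
∈-∖⁺ S (x ∷ xs) u∈ u∉ = ∈-∖⁺ (S - x) xs (x∈p∧x≢y⇒x∈p-y u∈ (u∉ ∘ here)) (u∉ ∘ there)

∖-extract : ∀ (S : Subset n) pre v post → S ∖ (pre ++ v ∷ post) ≡ (S - v) ∖ (pre ++ post)
∖-extract S [] v post = refl
∖-extract S (x ∷ pre) v post =
  trans (∖-extract (S - x) pre v post) (cong (_∖ (pre ++ post)) (p─x─y≡p─y─x S x v))

allVecs : ∀ {k} → Vec (List ℕ) k → List (Vec ℕ k)
allVecs [] = [ [] ]
allVecs (l ∷ ls) = cartesianProductWith _∷_ l (allVecs ls)

∈-allVecs⁺ : ∀ {k} (ls : Vec (List ℕ) k) {c} → (∀ i → lookup c i ∈ lookup ls i) → c ∈ allVecs ls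
∈-allVecs⁺ [] {[]} _ = here refl
∈-allVecs⁺ (l ∷ ls) {x ∷ c} c∈ = ∈-cartesianProductWith⁺ _∷_ (c∈ zero) (∈-allVecs⁺ ls (c∈ ∘ suc))

∈-allVecs⁻ : ∀ {k} (ls : Vec (List ℕ) k) {c} → c ∈ allVecs ls → ∀ i → lookup c i ∈ lookup ls i
∈-allVecs⁻ (l ∷ ls) c∈ i with ∈-cartesianProductWith⁻ _∷_ l (allVecs ls) c∈
∈-allVecs⁻ (l ∷ ls) c∈ zero | _ , _ , x∈ , _ , refl = x∈
∈-allVecs⁻ (l ∷ ls) c∈ (suc i) | _ , _ , _ , c∈′ , refl = ∈-allVecs⁻ ls c∈′ i

allVecs-unique : ∀ {k} (ls : Vec (List ℕ) k) → (∀ i → Unique (lookup ls i)) → Unique (allVecs ls)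
allVecs-unique [] _ = [] ∷ []
allVecs-unique (l ∷ ls) u = Unique.cartesianProductWith⁺ _∷_ ∷-injectiveVec (u zero) (allVecs-unique ls (u ∘ suc))

module PartialColourings {n} (G : Graph n) (L : ListAssignment n) where

  open import Data.List.Membership.DecPropositional (_≟_ {n}) using () renaming (_∈?_ to _∈ᴸ?_)

  -- Vertices outside S carry the junk colour 0, so that C_L(S) is a list of vectors of a fixed length.
  record Fits (S : Subset n) (c : Vec ℕ n) : Set where
    field
      on  : ∀ {u} → u ∈ₛ S → lookup c u ∈ L u
      off : ∀ {u} → u ∉ₛ S → lookup c u ≡ 0

  palette : Subset n → Fin n → List ℕ
  palette S u = if does (u ∈? S) then L u else [ 0 ]

  Fits⇒∈palette : ∀ {S c} → Fits S c → ∀ u → lookup c u ∈ palette S u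
  Fits⇒∈palette {S} c-fits u with u ∈? S
  ... | yes u∈S = Fits.on c-fits u∈S
  ... | no u∉S = here (Fits.off c-fits u∉S)

  ∈palette⇒Fits : ∀ {S c} → (∀ u → lookup c u ∈ palette S u) → Fits S c
  ∈palette⇒Fits {S} {c} ∈palette = record { on = on ; off = off }
    where
    on : ∀ {u} → u ∈ₛ S → lookup c u ∈ L u
    on {u} u∈S with u ∈? S | ∈palette u
    ... | yes _ | c[u]∈ = c[u]∈
    ... | no u∉S | _ = ⊥-elim (u∉S u∈S)
    off : ∀ {u} → u ∉ₛ S → lookup c u ≡ 0
    off {u} u∉S with u ∈? S | ∈palette u
    ... | yes u∈S | _ = ⊥-elim (u∉S u∈S)
    ... | no _ | here c[u]≡0 = c[u]≡0

  record BadPath (S : Subset n) (c : Vec ℕ n) (i : ℕ) (ps : List (Fin n)) : Set where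
    constructor badPath
    field
      path    : IsPath G ps
      within  : All (_∈ₛ S) ps
      repeats : HalvesMatch i (map (lookup c) ps)

  Bad : Subset n → Vec ℕ n → Set
  Bad S c = ∃[ i ] ∃[ ps ] BadPath S c i ps

  badPath? : ∀ S c i ps → Dec (BadPath S c i ps)
  badPath? S c i ps = map′ (λ (path , within , repeats) → badPath path within repeats)
                           (λ (badPath path within repeats) → path , within , repeats)
    (isPath? G ps ×-dec (All.all? (_∈? S) ps ×-dec halvesMatch? i (map (lookup c) ps)))

  -- A bad path has at most n vertices, so the search over listsUpTo n and i < n is exhaustive.
  bad? : ∀ S c → Dec (Bad S c)
  bad? S c = map′ found complete (Any.any? (λ i → Any.any? (badPath? S c i) (listsUpTo n)) (upTo n))
    where
    found : Any (λ i → Any (BadPath S c i) (listsUpTo n)) (upTo n) → Bad S c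
    found any with Any.satisfied any
    ... | i , any′ with Any.satisfied any′
    ...   | ps , bad = i , ps , bad
    complete : Bad S c → Any (λ i → Any (BadPath S c i) (listsUpTo n)) (upTo n)
    complete (i , ps , bad@(badPath path _ (len≡ , _))) =
      lose (∈-upTo⁺ (≤-trans (m≤m+n (suc i) (suc i)) length≤n)) (lose (∈-listsUpTo n ps ps≤n) bad)
      where
      ps≤n : length ps ≤ n
      ps≤n = Unique⇒length≤ (proj₁ path)
      length≤n : suc i + suc i ≤ n
      length≤n = subst (_≤ n) (trans (sym (length-map (lookup c) ps)) len≡) ps≤n

  CL : Subset n → List (Vec ℕ n)
  CL S = filter (λ c → ¬? (bad? S c)) (allVecs (tabulate (palette S)))

  ∈-CL⁺ : ∀ {S c} → Fits S c → ¬ Bad S c → c ∈ CL S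
  ∈-CL⁺ {S} {c} c-fits good = ∈-filter⁺ (λ c → ¬? (bad? S c))
    (∈-allVecs⁺ (tabulate (palette S)) (λ u →
      subst (lookup c u ∈_) (sym (lookup∘tabulate (palette S) u)) (Fits⇒∈palette c-fits u)))
    good

  ∈-CL⁻ : ∀ {S c} → c ∈ CL S → Fits S c × ¬ Bad S c
  ∈-CL⁻ {S} {c} c∈ with ∈-filter⁻ (λ c → ¬? (bad? S c)) c∈
  ... | c∈all , good =
    ∈palette⇒Fits (λ u →
      subst (lookup c u ∈_) (lookup∘tabulate (palette S) u) (∈-allVecs⁻ (tabulate (palette S)) c∈all u)) ,
    good

  CL-unique : (∀ u → Unique (L u)) → ∀ S → Unique (CL S)
  CL-unique L-unique S = Unique.filter⁺ (λ c → ¬? (bad? S c))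
    (allVecs-unique (tabulate (palette S)) (λ u →
      subst Unique (sym (lookup∘tabulate (palette S) u)) (palette-unique u)))
    where
    palette-unique : ∀ u → Unique (palette S u)
    palette-unique u with u ∈? S
    ... | yes _ = L-unique u
    ... | no _ = [] ∷ []

  BadPath-transfer : ∀ {S S′ c c′ i ps} → BadPath S c i ps → All (_∈ₛ S′) ps →
    (∀ {u} → u ∈ ps → lookup c u ≡ lookup c′ u) → BadPath S′ c′ i ps
  BadPath-transfer {i = i} {ps} (badPath path _ repeats) within′ agree =
    badPath path within′ (subst (HalvesMatch i) (map-cong-local (All.tabulate agree)) repeats)

  restrict : Subset n → Vec ℕ n → Vec ℕ n
  restrict S c = tabulate (λ u → if does (u ∈? S) then lookup c u else 0)

  lookup-restrict-inside : ∀ {S c u} → u ∈ₛ S → lookup (restrict S c) u ≡ lookup c u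
  lookup-restrict-inside {S} {c} {u} u∈S =
    trans (lookup∘tabulate _ u) (cong (λ b → if b then lookup c u else 0) (dec-true (u ∈? S) u∈S))

  lookup-restrict-outside : ∀ {S c u} → u ∉ₛ S → lookup (restrict S c) u ≡ 0
  lookup-restrict-outside {S} {c} {u} u∉S =
    trans (lookup∘tabulate _ u) (cong (λ b → if b then lookup c u else 0) (dec-false (u ∈? S) u∉S))

  restrict-fits : ∀ {S S′ c} → S′ ⊆ S → Fits S c → Fits S′ (restrict S′ c)
  restrict-fits {S′ = S′} {c} S′⊆S c-fits = record
    { on = λ {u} u∈S′ →
        subst (_∈ L u) (sym (lookup-restrict-inside {S′} {c} u∈S′)) (Fits.on c-fits (S′⊆S u∈S′))
    ; off = lookup-restrict-outside {S′} {c}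
    }

  restrict-good : ∀ {S S′ c c′} → S′ ⊆ S → (∀ {u} → u ∈ₛ S′ → lookup c′ u ≡ lookup c u) →
    ¬ Bad S c → ¬ Bad S′ (restrict S′ c′)
  restrict-good {S′ = S′} {c} {c′} S′⊆S agree good (i , ps , bad@(badPath _ within _)) =
    good (i , ps , BadPath-transfer bad (All.map S′⊆S within) (λ u∈ →
      let u∈S′ = All.lookup within u∈ in trans (lookup-restrict-inside {S′} {c′} u∈S′) (agree u∈S′)))

  -- Along a repetition every vertex of the first half has a twin of the same colour in the second half.
  repetition-determined : ∀ {S c₁ c₂ i ps} → Fits S c₁ → Fits S c₂ → Unique ps → All (_∈ₛ S) ps →
    HalvesMatch i (map (lookup c₁) ps) → HalvesMatch i (map (lookup c₂) ps) →
    restrict (S ∖ take (suc i) ps) c₁ ≡ restrict (S ∖ take (suc i) ps) c₂ → c₁ ≡ c₂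
  repetition-determined {S} {c₁} {c₂} {i} {ps} fits₁ fits₂ ps! within (len≡ , halves₁) (_ , halves₂) same =
    Pointwise-≡⇒≡ (ext agree)
    where
    j : ℕ
    j = suc i
    front back : List (Fin n)
    front = take j ps
    back = drop j ps
    len≡′ : length ps ≡ j + j
    len≡′ = trans (sym (length-map (lookup c₁) ps)) len≡
    off-front : ∀ {u} → u ∈ₛ S → u ∉ front → lookup c₁ u ≡ lookup c₂ u
    off-front {u} u∈S u∉ = begin
      lookup c₁ u                            ≡⟨ lookup-restrict-inside {c = c₁} u∈S∖front ⟨
      lookup (restrict (S ∖ front) c₁) u     ≡⟨ cong (λ r → lookup r u) same ⟩
      lookup (restrict (S ∖ front) c₂) u     ≡⟨ lookup-restrict-inside {c = c₂} u∈S∖front ⟩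
      lookup c₂ u                            ∎
      where
      open ≡-Reasoning
      u∈S∖front : u ∈ₛ S ∖ front
      u∈S∖front = ∈-∖⁺ S front u∈S u∉
    halves : ∀ c → take j (map (lookup c) ps) ≡ drop j (map (lookup c) ps) →
             map (lookup c) front ≡ map (lookup c) back
    halves c eq = trans (sym (take-map j ps)) (trans eq (drop-map j ps))
    agree : ∀ u → lookup c₁ u ≡ lookup c₂ u
    agree u with u ∈? S
    ... | no u∉S = trans (Fits.off fits₁ u∉S) (sym (Fits.off fits₂ u∉S))
    ... | yes u∈S with u ∈ᴸ? front
    ...   | no u∉ = off-front u∈S u∉
    ...   | yes u∈
      with partner {B = ℕ} front back u∈
                   (trans (length-take-half ps {j} len≡′) (sym (length-drop-half ps {j} len≡′)))
    ...     | w , w∈back , twin = begin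
      lookup c₁ u ≡⟨ twin (lookup c₁) (halves c₁ halves₁) ⟩
      lookup c₁ w ≡⟨ off-front (All.lookup within (∈-drop⁻ j ps w∈back))
                               (Unique-++-disjoint front (subst Unique (sym (take++drop≡id j ps)) ps!) w∈back) ⟩
      lookup c₂ w ≡⟨ twin (lookup c₂) (halves c₂ halves₂) ⟨
      lookup c₂ u ∎
      where open ≡-Reasoning

-- The induction

module Counting {n} (G : Graph n) (L : ListAssignment n) (L-unique : ∀ u → Unique (L u))
                (e : ℕ) (e≥1 : 1 ≤ e) (deg : MaxDegreeAtMost G (suc e))
                (p q : ℕ) (p>0 : 0 < p) (cond : ∀ u → StepCondition e (length (L u)) p q) where

  open PartialColourings G L
  open Candidates G e deg
  open import Data.List.Membership.DecPropositional (_≟_ {n}) using () renaming (_∈?_ to _∈ᴸ?_)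

  K : ℕ
  K = suc e * e * (p + q)

  Claim : ℕ → Set
  Claim k = ∀ S → ∣ S ∣ ≤ k → ∀ {v} → v ∈ₛ S → K * length (CL (S - v)) ≤ q * length (CL S)

  chain : ∀ {k} → Claim k → ∀ T ys → ∣ T ∣ ≤ k → Unique ys → All (_∈ₛ T) ys →
          K ^ length ys * length (CL (T ∖ ys)) ≤ q ^ length ys * length (CL T)
  chain claim T [] _ _ _ = ≤-refl
  chain {k} claim T (u ∷ ys) ∣T∣≤k (u∉ys ∷ ys!) (u∈T ∷ ys⊆T) = begin
    K * K ^ length ys * length (CL ((T - u) ∖ ys))  ≡⟨ *-assoc K (K ^ length ys) _ ⟩
    K * (K ^ length ys * length (CL ((T - u) ∖ ys)))
      ≤⟨ *-monoʳ-≤ K (chain claim (T - u) ys ∣T-u∣≤k ys! ys⊆T-u) ⟩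
    K * (q ^ length ys * length (CL (T - u)))        ≡⟨ swap K (q ^ length ys) _ ⟩
    q ^ length ys * (K * length (CL (T - u)))        ≤⟨ *-monoʳ-≤ (q ^ length ys) (claim T ∣T∣≤k u∈T) ⟩
    q ^ length ys * (q * length (CL T))              ≡⟨ swap′ q (q ^ length ys) _ ⟩
    q * q ^ length ys * length (CL T)                ∎
    where
    open ≤-Reasoning
    ∣T-u∣≤k : ∣ T - u ∣ ≤ k
    ∣T-u∣≤k = ≤-trans (<⇒≤ (x∈p⇒∣p-x∣<∣p∣ u∈T)) ∣T∣≤k
    ys⊆T-u : All (_∈ₛ T - u) ys
    ys⊆T-u = All.zipWith (λ (u≢y , y∈T) → x∈p∧x≢y⇒x∈p-y y∈T (u≢y ∘ sym)) (u∉ys , ys⊆T)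
    swap : ∀ a b c → a * (b * c) ≡ b * (a * c)
    swap = solve-∀
    swap′ : ∀ a b c → b * (a * c) ≡ a * b * c
    swap′ = solve-∀

  module InductionStep {k} (claim : Claim k) (S : Subset n) (∣S∣≤1+k : ∣ S ∣ ≤ suc k)
                       {v} (v∈S : v ∈ₛ S) where

    M : ℕ
    M = length (CL (S - v))

    Oriented : ℕ → List (Fin n) → Set
    Oriented i ps = IsPath G ps × All (_∈ₛ S) ps × length ps ≡ suc i + suc i × v ∈ take (suc i) ps

    oriented? : ∀ i ps → Dec (Oriented i ps)
    oriented? i ps =
      isPath? G ps ×-dec (All.all? (_∈? S) ps ×-dec ((length ps ≟ℕ suc i + suc i) ×-dec (v ∈ᴸ? take (suc i) ps)))

    Record : Set
    Record = ℕ × List (Fin n) × Vec ℕ n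

    records : ℕ → List Record
    records i = concatMap (λ ps → map (λ c → i , ps , c) (CL (S ∖ take (suc i) ps)))
                          (filter (oriented? i) (candidates v i))

    orient : ℕ → List (Fin n) → List (Fin n)
    orient i ps = if does (v ∈ᴸ? take (suc i) ps) then ps else reverse ps

    orient-oriented : ∀ {c i ps} → BadPath S c i ps → v ∈ ps →
      Oriented i (orient i ps) × HalvesMatch i (map (lookup c) (orient i ps))
    orient-oriented {c} {i} {ps} (badPath path within repeats) v∈ps with v ∈ᴸ? take (suc i) ps
    ... | yes v∈front = (path , within , length≡ , v∈front) , repeats
      where
      length≡ : length ps ≡ suc i + suc i
      length≡ = trans (sym (length-map (lookup c) ps)) (proj₁ repeats)
    ... | no v∉front =
      (IsPath-reverse G path , All.tabulate (All.lookup within ∘ Any.reverse⁻) ,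
        trans (length-reverse ps) length≡ , ∈-take-reverse ps length≡ v∈ps v∉front) ,
      subst (HalvesMatch i) (sym (reverse-map (lookup c) ps)) (HalvesMatch-reverse repeats)
      where
      length≡ : length ps ≡ suc i + suc i
      length≡ = trans (sym (length-map (lookup c) ps)) (proj₁ repeats)

    encode : (c : Vec ℕ n) → Dec (Bad S c) → Vec ℕ n ⊎ Record
    encode c (no _) = inj₁ c
    encode c (yes (i , ps , _)) = inj₂ (i , orient i ps , restrict (S ∖ take (suc i) (orient i ps)) c)

    BadPathsThroughV : Vec ℕ n → Set
    BadPathsThroughV c = ∀ {i ps} → BadPath S c i ps → v ∈ ps

    encode-injective : ∀ {c₁ c₂} (d₁ : Dec (Bad S c₁)) (d₂ : Dec (Bad S c₂)) → Fits S c₁ → Fits S c₂ →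
      BadPathsThroughV c₁ → BadPathsThroughV c₂ → encode c₁ d₁ ≡ encode c₂ d₂ → c₁ ≡ c₂
    encode-injective (no _) (no _) _ _ _ _ refl = refl
    encode-injective {c₁} {c₂} (yes (_ , _ , bad₁)) (yes (_ , _ , bad₂)) fits₁ fits₂ through₁ through₂ eq
      with orient-oriented bad₁ (through₁ bad₁) | orient-oriented bad₂ (through₂ bad₂)
    ... | oriented₁ , repeats₁ | _ , repeats₂ = decode oriented₁ repeats₁ repeats₂ (inj₂-injective eq)
      where
      decode : ∀ {i₁ i₂ qs₁ qs₂} → Oriented i₁ qs₁ →
        HalvesMatch i₁ (map (lookup c₁) qs₁) → HalvesMatch i₂ (map (lookup c₂) qs₂) →
        (i₁ , qs₁ , restrict (S ∖ take (suc i₁) qs₁) c₁) ≡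
        (i₂ , qs₂ , restrict (S ∖ take (suc i₂) qs₂) c₂) →
        c₁ ≡ c₂
      decode (path , within , _) repeats₁ repeats₂ same
        with cong proj₁ same | cong (proj₁ ∘ proj₂) same | cong (proj₂ ∘ proj₂) same
      ... | refl | refl | same-restriction =
        repetition-determined fits₁ fits₂ (proj₁ path) within repeats₁ repeats₂ same-restriction

    Target : List (Vec ℕ n ⊎ Record)
    Target = map inj₁ (CL S) ++ map inj₂ (concatBelow n records)

    module Extended {x c′} (x∈ : x ∈ L v) (c′∈ : c′ ∈ CL (S - v)) where

      c : Vec ℕ n
      c = c′ [ v ]≔ x

      c′-fits : Fits (S - v) c′
      c′-fits = proj₁ (∈-CL⁻ c′∈)

      c′-good : ¬ Bad (S - v) c′
      c′-good = proj₂ (∈-CL⁻ c′∈)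

      zero-at-v : lookup c′ v ≡ 0
      zero-at-v = Fits.off c′-fits (λ v∈ → x∈p-y⇒x≢y S v∈ refl)

      agrees : ∀ {u} → u ≢ v → lookup c u ≡ lookup c′ u
      agrees u≢v = lookup∘update′ u≢v c′ x

      fits : Fits S c
      fits = record { on = on ; off = off }
        where
        on : ∀ {u} → u ∈ₛ S → lookup c u ∈ L u
        on {u} u∈S with u ≟ v
        ... | yes refl = subst (_∈ L v) (sym (lookup∘update v c′ x)) x∈
        ... | no u≢v = subst (_∈ L u) (sym (agrees u≢v)) (Fits.on c′-fits (x∈p∧x≢y⇒x∈p-y u∈S u≢v))
        off : ∀ {u} → u ∉ₛ S → lookup c u ≡ 0
        off {u} u∉S with u ≟ v
        ... | yes refl = contradiction v∈S u∉S
        ... | no u≢v = trans (agrees u≢v) (Fits.off c′-fits (u∉S ∘ p─q⊆p S _))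

      through-v : BadPathsThroughV c
      through-v {i} {ps} bad@(badPath _ within _) with v ∈ᴸ? ps
      ... | yes v∈ps = v∈ps
      ... | no v∉ps = contradiction (i , ps , BadPath-transfer bad within⁻ (λ u∈ → agrees (avoids u∈))) c′-good
        where
        avoids : ∀ {u} → u ∈ ps → u ≢ v
        avoids u∈ refl = v∉ps u∈
        within⁻ : All (_∈ₛ S - v) ps
        within⁻ = All.tabulate (λ u∈ → x∈p∧x≢y⇒x∈p-y (All.lookup within u∈) (avoids u∈))

      encode-∈ : ∀ d → encode c d ∈ Target
      encode-∈ (no good) = ∈-++⁺ˡ (∈-map⁺ inj₁ (∈-CL⁺ fits good))
      encode-∈ (yes (i , ps , bad)) with orient-oriented bad (through-v bad)
      ... | oriented@(path , within , length≡ , v∈front) , _ =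
        ∈-++⁺ʳ (map inj₁ (CL S)) (∈-map⁺ inj₂ (∈-concatBelow records i<n
          (∈-concatMap-intro (∈-filter⁺ (oriented? i) (∈-candidates path length≡ v∈front) oriented)
                             (∈-map⁺ (λ c → i , qs , c) (∈-CL⁺ (restrict-fits (∖-⊆ S front) fits) good)))))
        where
        qs front : List (Fin n)
        qs = orient i ps
        front = take (suc i) qs
        i<n : i < n
        i<n = ≤-trans (m≤m+n (suc i) (suc i)) (subst (_≤ n) length≡ (Unique⇒length≤ (proj₁ path)))
        avoids : ∀ {u} → u ∈ₛ S ∖ front → u ≢ v
        avoids u∈ refl = ∈-∖⁻ S front u∈ v∈front
        good : ¬ Bad (S ∖ front) (restrict (S ∖ front) c)
        good = restrict-good {c′ = c} (λ u∈ → x∈p∧x≢y⇒x∈p-y (∖-⊆ S front u∈) (avoids u∈))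
                             (agrees ∘ avoids) c′-good

    Choices : List (ℕ × Vec ℕ n)
    Choices = cartesianProduct (L v) (CL (S - v))

    -- The injection: colour v by x; if this creates a repetition, record where it is instead.
    φ : ℕ × Vec ℕ n → Vec ℕ n ⊎ Record
    φ (x , c′) = encode (c′ [ v ]≔ x) (bad? S (c′ [ v ]≔ x))

    φ-∈ : ∀ {xc} → xc ∈ Choices → φ xc ∈ Target
    φ-∈ {x , c′} xc∈ with ∈-cartesianProduct⁻ (L v) (CL (S - v)) xc∈
    ... | x∈ , c′∈ = Extended.encode-∈ x∈ c′∈ (bad? S (c′ [ v ]≔ x))

    φ-injective : ∀ {xc₁ xc₂} → xc₁ ∈ Choices → xc₂ ∈ Choices → φ xc₁ ≡ φ xc₂ → xc₁ ≡ xc₂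
    φ-injective {x₁ , c₁} {x₂ , c₂} xc₁∈ xc₂∈ eq =
      cong₂ _,_ (proj₁ x₁≡x₂×c₁≡c₂) (proj₂ x₁≡x₂×c₁≡c₂)
      where
      choice₁ : x₁ ∈ L v × c₁ ∈ CL (S - v)
      choice₁ = ∈-cartesianProduct⁻ (L v) (CL (S - v)) xc₁∈
      choice₂ : x₂ ∈ L v × c₂ ∈ CL (S - v)
      choice₂ = ∈-cartesianProduct⁻ (L v) (CL (S - v)) xc₂∈
      module E₁ = Extended (proj₁ choice₁) (proj₂ choice₁)
      module E₂ = Extended (proj₁ choice₂) (proj₂ choice₂)
      x₁≡x₂×c₁≡c₂ : x₁ ≡ x₂ × c₁ ≡ c₂
      x₁≡x₂×c₁≡c₂ = []≔-injective (trans E₁.zero-at-v (sym E₂.zero-at-v))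
        (encode-injective (bad? S E₁.c) (bad? S E₂.c) E₁.fits E₂.fits E₁.through-v E₂.through-v eq)

    count : length (L v) * M ≤ length (CL S) + sumBelow n (length ∘ records)
    count = begin
      length (L v) * M  ≡⟨ length-cartesianProduct (L v) (CL (S - v)) ⟨
      length Choices                      ≤⟨ injection⇒length≤ _≟T_ φ choices-unique φ-∈ φ-injective ⟩
      length Target                       ≡⟨ length-++ (map inj₁ (CL S)) ⟩
      length (map inj₁ (CL S)) + length (map inj₂ (concatBelow n records))
        ≡⟨ cong₂ _+_ (length-map inj₁ (CL S)) (length-map inj₂ (concatBelow n records)) ⟩
      length (CL S) + length (concatBelow n records) ≡⟨ cong (length (CL S) +_) (length-concatBelow n records) ⟩
      length (CL S) + sumBelow n (length ∘ records) ∎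
      where
      open ≤-Reasoning
      choices-unique : Unique Choices
      choices-unique = Unique.cartesianProduct⁺ (L-unique v) (CL-unique L-unique (S - v))
      _≟T_ : DecidableEquality (Vec ℕ n ⊎ Record)
      _≟T_ = ≡-dec⊎ (≡-decVec _≟ℕ_) (≡-dec× _≟ℕ_ (≡-dec× (≡-decList _≟_) (≡-decVec _≟ℕ_)))

    record-bound : ∀ {i ps} → Oriented i ps → K ^ i * length (CL (S ∖ take (suc i) ps)) ≤ q ^ i * M
    record-bound {i} {ps} (path , within , length≡ , v∈front) with ∈-∃++ v∈front
    ... | pre , post , front≡ with Unique-remove pre (subst Unique front≡ (Unique.take⁺ (suc i) (proj₁ path)))
    ...   | rest! , v∉rest =
      subst₂ (λ j X → K ^ j * length (CL X) ≤ q ^ j * M) rest-length (sym S∖front≡)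
        (chain claim (S - v) (pre ++ post) ∣S-v∣≤k rest! rest⊆S-v)
      where
      ∣S-v∣≤k : ∣ S - v ∣ ≤ k
      ∣S-v∣≤k = ≤-pred (≤-trans (x∈p⇒∣p-x∣<∣p∣ v∈S) ∣S∣≤1+k)
      S∖front≡ : S ∖ take (suc i) ps ≡ (S - v) ∖ (pre ++ post)
      S∖front≡ = trans (cong (S ∖_) front≡) (∖-extract S pre v post)
      rest⊆S-v : All (_∈ₛ S - v) (pre ++ post)
      rest⊆S-v = All.tabulate (λ {u} u∈ → x∈p∧x≢y⇒x∈p-y
        (All.lookup within (∈-take⁻ (suc i) ps (subst (u ∈_) (sym front≡) (∈-++-insert pre u∈))))
        (λ { refl → v∉rest u∈ }))
      rest-length : length (pre ++ post) ≡ i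
      rest-length = suc-injective (begin
        suc (length (pre ++ post))          ≡⟨ cong suc (length-++ pre) ⟩
        suc (length pre + length post)      ≡⟨ +-suc (length pre) (length post) ⟨
        length pre + length (v ∷ post)      ≡⟨ length-++ pre ⟨
        length (pre ++ v ∷ post)            ≡⟨ cong length front≡ ⟨
        length (take (suc i) ps)            ≡⟨ length-take-half ps {suc i} length≡ ⟩
        suc i                               ∎)
        where open ≡-Reasoning

    records-bound : ∀ i → K ^ i * length (records i) ≤ suc i * (suc e * e ^ (i + i)) * (q ^ i * M)
    records-bound i = ≤-trans
      (scaled-length-concatMap-≤ _ (filter (oriented? i) (candidates v i)) {K ^ i} (λ {ps} ps∈ →
        subst (λ z → K ^ i * z ≤ q ^ i * M) (sym (length-map _ (CL (S ∖ take (suc i) ps))))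
              (record-bound (proj₂ (∈-filter⁻ (oriented? i) {xs = candidates v i} ps∈)))))
      (*-monoˡ-≤ (q ^ i * M) (≤-trans (length-filter (oriented? i) (candidates v i)) (length-candidates v i)))

    bound : K * M ≤ q * length (CL S)
    bound = step-inequality e p q (M) (length ∘ records) p>0 first later
             (length (L v)) (length (CL S)) n (cond v) count
      where
      normalise : ∀ a M → 1 * (a * 1) * (1 * M) ≡ a * M
      normalise = solve-∀
      first : length (records 0) ≤ suc e * M
      first = subst₂ _≤_ (+-identityʳ _) (normalise (suc e) _) (records-bound 0)
      later : ∀ i → (p + q) ^ suc i * length (records (suc i)) ≤ suc (suc i) * q ^ suc i * (e * M)
      later i = later-term-bound e (p + q) q _ i _ e≥1 (records-bound (suc i))

  claim : ∀ k → Claim k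
  claim zero S ∣S∣≤0 v∈S = contradiction (≤-trans (x∈p⇒∣p-x∣<∣p∣ v∈S) ∣S∣≤0) λ ()
  claim (suc k) S ∣S∣≤1+k v∈S = InductionStep.bound (claim k) S ∣S∣≤1+k v∈S

-- From C(V) and C(V - v) to the enumerations

avoids⇒punchIn-image : ∀ {m} {v : Fin (suc m)} ps → All (_≢ v) ps → ∃[ qs ] ps ≡ map (punchIn v) qs
avoids⇒punchIn-image [] [] = [] , refl
avoids⇒punchIn-image {v = v} (u ∷ ps) (u≢v ∷ avoid) with avoids⇒punchIn-image ps avoid
... | qs , refl = punchOut (u≢v ∘ sym) ∷ qs , cong (_∷ map (punchIn v) qs) (sym (punchIn-punchOut (u≢v ∘ sym)))

module _ {m} (G : Graph (suc m)) (L : ListAssignment (suc m)) (L-unique : ∀ u → Unique (L u)) where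

  open PartialColourings G L

  length-CL-⊤ : ∀ {cs} → Enumerates (InCL G L) cs → length (CL ⊤) ≤ length cs
  length-CL-⊤ (_ , enumerates) = injection⇒length≤ (≡-decVec _≟ℕ_) id (CL-unique L-unique ⊤)
    (λ {c} c∈ → let c-fits , good = ∈-CL⁻ c∈ in proj₂ (enumerates c)
      ( (λ u → Fits.on c-fits ∈⊤)
      , NoRepetitivePath⇒NonRep G c (λ i ps path repeats →
          good (i , ps , badPath path (All.tabulate (λ _ → ∈⊤)) repeats))))
    (λ _ _ eq → eq)

  module _ (v : Fin (suc m)) where

    G′ : Graph m
    G′ = deleteVertex G v
    L′ : ListAssignment m
    L′ i = L (punchIn v i)

    insertAt-∈-CL : ∀ {d} → InCL G′ L′ d → insertAt d v 0 ∈ CL (⊤ - v)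
    insertAt-∈-CL {d} (coloured , nonrep) = ∈-CL⁺ (record { on = on ; off = off }) good
      where
      c : Vec ℕ (suc m)
      c = insertAt d v 0
      on : ∀ {u} → u ∈ₛ ⊤ - v → lookup c u ∈ L u
      on {u} u∈ with v ≟ u
      ... | yes refl = contradiction refl (x∈p-y⇒x≢y ⊤ u∈)
      ... | no v≢u = subst (λ w → lookup c w ∈ L w) (punchIn-punchOut v≢u)
                       (subst (_∈ L (punchIn v (punchOut v≢u))) (sym (insertAt-punchIn d v 0 (punchOut v≢u)))
                              (coloured (punchOut v≢u)))
      off : ∀ {u} → u ∉ₛ ⊤ - v → lookup c u ≡ 0
      off {u} u∉ with u ≟ v
      ... | yes refl = insertAt-lookup d v 0
      ... | no u≢v = contradiction (x∈p∧x≢y⇒x∈p-y ∈⊤ u≢v) u∉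
      good : ¬ Bad (⊤ - v) c
      good (i , ps , badPath (ps! , linked) within repeats)
        with avoids⇒punchIn-image ps (All.map (x∈p-y⇒x≢y ⊤) within)
      ... | qs , refl = NonRep⇒NoRepetitivePath G′ d nonrep i qs (Unique.map⁻ ps! , Linked.map⁻ linked)
                          (subst (HalvesMatch i) colours≡ repeats)
        where
        colours≡ : map (lookup c) (map (punchIn v) qs) ≡ map (lookup d) qs
        colours≡ = trans (sym (map-∘ qs)) (map-cong (insertAt-punchIn d v 0) qs)

    length-CL-⊤-v : ∀ {cs′} → Enumerates (InCL G′ L′) cs′ → length cs′ ≤ length (CL (⊤ - v))
    length-CL-⊤-v (cs′! , enumerates) = injection⇒length≤ (≡-decVec _≟ℕ_) (λ d → insertAt d v 0) cs′!
      (λ {d} d∈ → insertAt-∈-CL (proj₁ (enumerates d) d∈))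
      (λ {d₁} {d₂} _ _ eq →
        trans (sym (removeAt-insertAt d₁ v 0)) (trans (cong (λ c → removeAt c v) eq) (removeAt-insertAt d₂ v 0)))

lemma2 : (Δ : ℕ) → 2 ≤ Δ →
    (m : ℕ) (G : Graph (suc m)) (L : ListAssignment (suc m)) →
    MaxDegreeAtMost G Δ →
    (∀ u → Unique (L u)) →
    (∀ u → ListSizeBound Δ (length (L u))) →
    (v : Fin (suc m)) →
    (cs : List (Vec ℕ (suc m))) → Enumerates (InCL G L) cs →
    (cs' : List (Vec ℕ m)) →
    Enumerates (InCL (deleteVertex G v) (λ i → L (punchIn v i))) cs' →
    CountBound Δ (length cs) (length cs')
lemma2 (suc e) (s≤s e≥1) m G L deg L-unique list-bounds v cs cs-enum cs′ cs′-enum =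
  CountBound-from-ratio e p q (length cs) (length cs′) q>0 above-root (begin
    K * length cs′           ≤⟨ *-monoʳ-≤ K (length-CL-⊤-v G L L-unique v cs′-enum) ⟩
    K * length (CL (⊤ - v))  ≤⟨ claim _ ⊤ ≤-refl {v} ∈⊤ ⟩
    q * length (CL ⊤)        ≤⟨ *-monoʳ-≤ q (length-CL-⊤ G L L-unique cs-enum) ⟩
    q * length cs            ∎)
  where
  open GoodRatio (good-ratio e e≥1)
  open PartialColourings G L using (CL)
  open Counting G L L-unique e e≥1 deg p q p>0 (λ u → condition _ (list-bounds u))
  open ≤-Reasoning
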